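{- (i) For every polynomial time computable function $f:\{0,1\}^*\to\{0,1\}^*$ there are a term $M_f$ and an integer $n_f$ such that $\vdash M_f:\mathbb{B}^{n_f}\multimap\mathbb{B}^0$ is derivable in $\mathsf{RH}(\emptyset)$ and $M_f$ represents $f$. (ii) For every elementary time computable function $f:\{0,1\}^*\to\{0,1\}^*$ there are a term $M_f$ and an integer $n_f$ such that $\vdash M_f:\mathbb{B}^{n_f}\multimap\mathbb{B}^0$ is derivable in $\mathsf{RH}(\mathsf{A})$ and $M_f$ represents $f$. Here "$M_f$ represents $f$" means $M_f\,\ulcorner s\urcorner\leadsto^*\ulcorner f(s)\urcorner$ for every $s\in\{0,1\}^*$.
   Context: Free algebras: a free algebra $\mathbb{A}=(\mathcal{C}_\mathbb{A},\mathcal{R}_\mathbb{A})$: finite constructor set $\{c^\mathbb{A}_1,\dots,c^\mathbb{A}_{k(\mathbb{A})}\}$ with arities. $\mathscr{A}$ is a fixed finite family of free algebras with pairwise disjoint constructor sets containing: $\mathbb{U}$ ($c_1^\mathbb{U}$ unary, $c_2^\mathbb{U}$ nullary), $\mathbb{B}$ ($c_1^\mathbb{B},c_2^\mathbb{B}$ unary, $c_3^\mathbb{B}$ nullary), $\mathbb{C}$ ($c_1^\mathbb{C}$ binary, $c_2^\mathbb{C}$ nullary), $\mathbb{D}$ ($c_1^\mathbb{D},c_2^\mathbb{D}$ binary, $c_3^\mathbb{D}$ nullary). Binary strings are encoded as $\ulcorner\varepsilon\urcorner=c_3^\mathbb{B}$, $\ulcorner 0s\urcorner=c_1^\mathbb{B}\ulcorner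 s\urcorner$, $\ulcorner 1s\urcorner=c_2^\mathbb{B}\ulcorner s\urcorner$. Terms: $M::=x\mid c\mid MM\mid \lambda x.M\mid M\{\!\{M,\dots,M\}\!\}\mid M\langle\!\langle M,\dots,M\rangle\!\rangle$. Types: $A::=\mathbb{A}^n\mid A\multimap A$. $A\multimap^0B=B$, $A\multimap^{n+1}B=A\multimap(A\multimap^nB)$; level $V(\mathbb{A}^n)=n$, $V(A\multimap B)=\max\{V(A),V(B)\}$. Typing rules: (A) $x:A\vdash x:A$; (W) from $\Gamma\vdash M:B$ infer $\Gamma,x:A\vdash M:B$; (C) from $\Gamma,x:A,y:A\vdash M:B$ infer $\Gamma,z:A\vdash M\{z/x,z/y\}:B$; ($I_\multimap$) from $\Gamma,x:A\vdash M:B$ infer $\Gamma\vdash\lambda x.M:A\multimap B$; ($E_\multimap$) from $\Gamma\vdash M:A\multimap B$, $\Delta\vdash N:A$ infer $\Gamma,\Delta\vdash MN:B$; ($I_\mathbb{A}$) $\vdash c:\mathbb{A}^n\multimap^{\mathcal{R}(c)}\mathbb{A}^n$; ($E^C_\mathbb{A}$) from $\Gamma_i\vdash M_{c^\mathbb{A}_i}:\mathbb{A}^m\multimap^{\mathcal{R}(c^\mathbb{A}_i)}C$ and $\Delta\vdash L:\mathbb{A}^m$ infer $\Gamma_1,\dots,\Gamma_{k(\mathbb{A})},\Delta\vdash L\{\!\{M_{c_1^\mathbb{A}},\dots\}\!\}:C$; ($E^R_\mathbb{A}$) from $\Gamma_i\vdash M_{c^\mathbb{A}_i}:\mathbb{A}^m\multimap^{\mathcal{R}(c^\mathbb{A}_i)}(C\multimap^{\mathcal{R}(c^\mathbb{A}_i)}C)$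 and $\Delta\vdash L:\mathbb{A}^m$ infer $\Gamma_1,\dots,\Gamma_{k(\mathbb{A})},\Delta\vdash L\langle\!\langle M_{c_1^\mathbb{A}},\dots\rangle\!\rangle:C$. For a class of types $\mathsf{D}$, $\mathsf{RH}(\mathsf{D})$ uses these rules, allowing rule (C) only when the contracted type is in $\mathsf{D}$, requiring all types in each $\Gamma_i$ of $E^R_\mathbb{A}$ to be in $\mathsf{D}$, and adding to $E^R_\mathbb{A}$ the premise $m>V(C)$. $\mathsf{A}=\{\mathbb{A}^n:\mathbb{A}\in\mathscr{A},n\in\mathbb{N}\}$; thus $\mathsf{RH}(\emptyset)$ forbids (C) altogether and requires empty $\Gamma_i$ in $E^R$. Values $V::=x\mid\lambda x.M\mid T$, $T::=c\mid TT$. Reduction $\to$: $(\lambda x.M)V\to M\{V/x\}$; $c_i^\mathbb{A}t_1\cdots t_r\{\!\{M_{c_1},\dots,M_{c_k}\}\!\}\to M_{c_i}t_1\cdots t_r$; $c_i^\mathbb{A}t_1\cdots t_r\langle\!\langle\vec M\rangle\!\rangle\to M_{c_i}t_1\cdots t_r(t_1\langle\!\langle\vec M\rangle\!\rangle)\cdots(t_r\langle\!\langle\vec M\rangle\!\rangle)$ with $r=\mathcal{R}(c_i^\mathbb{A})$, $t_j$ constructor terms. $\leadsto$ is the closure of $\to$ under application contexts on both sides and under the scrutinee position of conditionals/recursions (not under $\lambda$, not inside branches); $\leadsto^*$ its reflexive-transitive closure. Elementary time computable: computable by a Turing machine in time bounded by an elementary function (a tower of exponentials $2^{2^{\cdot^{\cdot^{2^n}}}}$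 of fixed height). -}

module Defs where

open import Data.Nat using (ℕ; zero; suc; _+_; _^_; _<_; _⊔_; _≟_)
open import Data.Fin using (Fin; toℕ) renaming (zero to fz; suc to fs)
open import Data.List using (List; []; _∷_; _++_; length; concat; tabulate; map; foldl; lookup)
open import Data.List.Relation.Unary.Unique.Propositional using (Unique)
open import Data.List.Relation.Unary.All using (All)
open import Data.List.Relation.Binary.Permutation.Propositional using (_↭_)
open import Data.List.Membership.Propositional using (_∉_)
open import Data.Product using (Σ; _×_; _,_; proj₁; proj₂)
open import Data.Bool using (Bool; true; false)
open import Data.Maybe using (Maybe; just; nothing)
open import Data.Empty using (⊥)
open import Relation.Binary.PropositionalEquality using (_≡_)
open import Relation.Binary.Construct.Closure.ReflexiveTransitive using (Star)
open import Relation.Nullary using (yes; no)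

-- It always contains
-- 𝕌, 𝔹, ℂ, 𝔻 (with the prescribed constructor arities) plus finitely
-- many further algebras, each given by the list of the arities of its
-- constructors.  Constructors are pairs (algebra , index), so the
-- constructor sets are pairwise disjoint by construction.

record Family : Set where
  field
    extra        : ℕ
    extraArities : Fin extra → List ℕ

module Lang (𝔉 : Family) where
  open Family 𝔉

  data Alg : Set where
    𝕌 𝔹 ℂ 𝔻 : Alg
    ext     : Fin extra → Alg

  arities : Alg → List ℕ
  arities 𝕌       = 1 ∷ 0 ∷ []
  arities 𝔹       = 1 ∷ 1 ∷ 0 ∷ []
  arities ℂ       = 2 ∷ 0 ∷ []
  arities 𝔻       = 2 ∷ 2 ∷ 0 ∷ []
  arities (ext j) = extraArities j

  nCons : Alg → ℕ
  nCons a = length (arities a)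

  -- constructor c_i^𝔸 is (𝔸 , i)  (i counted from 0)
  Con : Set
  Con = Σ Alg (λ a → Fin (nCons a))

  arity : Con → ℕ
  arity (a , i) = lookup (arities a) i

  Var : Set
  Var = ℕ

  infixl 7 _·_
  data Tm : Set where
    var  : Var → Tm
    con  : Con → Tm
    _·_  : Tm → Tm → Tm
    lam  : Var → Tm → Tm
    cond : Tm → List Tm → Tm
    rec  : Tm → List Tm → Tm

  -- substitution M{N/x} (stops at binders of x; capture-free whenever
  -- N is closed, which is the case for all reductions of closed terms,
  -- and for the renamings in rule (C) thanks to its freshness premise)
  mutual
    subst : Tm → Var → Tm → Tm
    subst (var y) x N with x ≟ y
    ... | yes _ = N
    ... | no  _ = var y
    subst (con c) x N = con c
    subst (M₁ · M₂) x N = subst M₁ x N · subst M₂ x N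
    subst (lam y M) x N with x ≟ y
    ... | yes _ = lam y M
    ... | no  _ = lam y (subst M x N)
    subst (cond L Ms) x N = cond (subst L x N) (substs Ms x N)
    subst (rec L Ms) x N = rec (subst L x N) (substs Ms x N)

    substs : List Tm → Var → Tm → List Tm
    substs [] x N = []
    substs (M ∷ Ms) x N = subst M x N ∷ substs Ms x N

  mutual
    boundVars : Tm → List Var
    boundVars (var y) = []
    boundVars (con c) = []
    boundVars (M₁ · M₂) = boundVars M₁ ++ boundVars M₂
    boundVars (lam y M) = y ∷ boundVars M
    boundVars (cond L Ms) = boundVars L ++ boundVarss Ms
    boundVars (rec L Ms) = boundVars L ++ boundVarss Ms

    boundVarss : List Tm → List Var
    boundVarss [] = []
    boundVarss (M ∷ Ms) = boundVars M ++ boundVarss Ms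

  infixr 5 _⊸_
  data Ty : Set where
    base : Alg → ℕ → Ty
    _⊸_  : Ty → Ty → Ty

  _⊸[_]_ : Ty → ℕ → Ty → Ty
  A ⊸[ zero ] B  = B
  A ⊸[ suc n ] B = A ⊸ (A ⊸[ n ] B)

  level : Ty → ℕ
  level (base a n) = n
  level (A ⊸ B)    = level A ⊔ level B

  -- Contexts: lists of distinct variable declarations (exchange is an
  -- explicit rule, so they behave as finite sets of declarations)

  Ctx : Set
  Ctx = List (Var × Ty)

  dom : Ctx → List Var
  dom Γ = map proj₁ Γ

  data RH (𝖣 : Ty → Set) : Ctx → Tm → Ty → Set where
    ax    : ∀ {x A} → RH 𝖣 ((x , A) ∷ []) (var x) A
    weak  : ∀ {Γ M B x A} → RH 𝖣 Γ M B → x ∉ dom Γ →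
            RH 𝖣 ((x , A) ∷ Γ) M B
    contr : ∀ {Γ M B x y z A} → 𝖣 A →
            RH 𝖣 ((x , A) ∷ (y , A) ∷ Γ) M B →
            z ∉ dom Γ → z ∉ boundVars M →
            RH 𝖣 ((z , A) ∷ Γ) (subst (subst M x (var z)) y (var z)) B
    exch  : ∀ {Γ Δ M B} → Γ ↭ Δ → RH 𝖣 Γ M B → RH 𝖣 Δ M B
    lamI  : ∀ {Γ x A M B} → RH 𝖣 ((x , A) ∷ Γ) M B →
            RH 𝖣 Γ (lam x M) (A ⊸ B)
    appE  : ∀ {Γ Δ M N A B} → RH 𝖣 Γ M (A ⊸ B) → RH 𝖣 Δ N A →
            Unique (dom (Γ ++ Δ)) → RH 𝖣 (Γ ++ Δ) (M · N) B
    conI  : (c : Con) (n : ℕ) →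
            RH 𝖣 [] (con c) (base (proj₁ c) n ⊸[ arity c ] base (proj₁ c) n)
    condE : ∀ {Δ L C} (a : Alg) (m : ℕ)
            (Γs : Fin (nCons a) → Ctx) (Ms : Fin (nCons a) → Tm) →
            ((i : Fin (nCons a)) →
               RH 𝖣 (Γs i) (Ms i) (base a m ⊸[ arity (a , i) ] C)) →
            RH 𝖣 Δ L (base a m) →
            Unique (dom (concat (tabulate Γs) ++ Δ)) →
            RH 𝖣 (concat (tabulate Γs) ++ Δ) (cond L (tabulate Ms)) C
    recE  : ∀ {Δ L C} (a : Alg) (m : ℕ)
            (Γs : Fin (nCons a) → Ctx) (Ms : Fin (nCons a) → Tm) →
            ((i : Fin (nCons a)) →
               RH 𝖣 (Γs i) (Ms i)
                 (base a m ⊸[ arity (a , i) ] (C ⊸[ arity (a , i) ] C))) →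
            ((i : Fin (nCons a)) → All (λ d → 𝖣 (proj₂ d)) (Γs i)) →
            level C < m →
            RH 𝖣 Δ L (base a m) →
            Unique (dom (concat (tabulate Γs) ++ Δ)) →
            RH 𝖣 (concat (tabulate Γs) ++ Δ) (rec L (tabulate Ms)) C

  NoTypes : Ty → Set
  NoTypes _ = ⊥

  BaseTypes : Ty → Set
  BaseTypes A = Σ Alg (λ a → Σ ℕ (λ n → A ≡ base a n))

  data IsCT : Tm → Set where
    ctCon : ∀ {c} → IsCT (con c)
    ctApp : ∀ {T T'} → IsCT T → IsCT T' → IsCT (T · T')

  data Spine : Tm → Con → List Tm → Set where
    spCon : ∀ {c} → Spine (con c) c []
    spApp : ∀ {T c ts t} → Spine T c ts → IsCT t →
            Spine (T · t) c (ts ++ t ∷ [])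

  data Value : Tm → Set where
    vVar : ∀ {x} → Value (var x)
    vLam : ∀ {x M} → Value (lam x M)
    vCT  : ∀ {T} → IsCT T → Value T

  data Nth {A : Set} : List A → ℕ → A → Set where
    here  : ∀ {x xs} → Nth (x ∷ xs) zero x
    there : ∀ {x xs n y} → Nth xs n y → Nth (x ∷ xs) (suc n) y

  applyAll : Tm → List Tm → Tm
  applyAll M ts = foldl _·_ M ts

  infix 4 _⟶_ _↝_ _↝*_
  data _⟶_ : Tm → Tm → Set where
    β  : ∀ {x M V} → Value V → lam x M · V ⟶ subst M x V
    ιc : ∀ {T c ts Ms M} → Spine T c ts → length ts ≡ arity c →
         Nth Ms (toℕ (proj₂ c)) M →
         cond T Ms ⟶ applyAll M ts
    ιr : ∀ {T c ts Ms M} → Spine T c ts → length ts ≡ arity c →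
         Nth Ms (toℕ (proj₂ c)) M →
         rec T Ms ⟶ applyAll (applyAll M ts) (map (λ t → rec t Ms) ts)

  data _↝_ : Tm → Tm → Set where
    top   : ∀ {M N} → M ⟶ N → M ↝ N
    appL  : ∀ {M M' N} → M ↝ M' → M · N ↝ M' · N
    appR  : ∀ {M N N'} → N ↝ N' → M · N ↝ M · N'
    condS : ∀ {L L' Ms} → L ↝ L' → cond L Ms ↝ cond L' Ms
    recS  : ∀ {L L' Ms} → L ↝ L' → rec L Ms ↝ rec L' Ms

  _↝*_ : Tm → Tm → Set
  _↝*_ = Star _↝_

  -- Encoding of binary strings (false = 0, true = 1)

  encode : List Bool → Tm
  encode []          = con (𝔹 , fs (fs fz))
  encode (false ∷ s) = con (𝔹 , fz) · encode s
  encode (true ∷ s)  = con (𝔹 , fs fz) · encode s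

  Represents : Tm → (List Bool → List Bool) → Set
  Represents M f = (s : List Bool) → M · encode s ↝* encode (f s)

-- Deterministic single-tape Turing machines.
-- Tape alphabet Fin (3 + nExtra): 0 = blank, 1 = bit 0, 2 = bit 1,
-- others = auxiliary symbols.  δ q a = nothing means "halt".

data Move : Set where
  left right stay : Move

record TM : Set where
  field
    nStates : ℕ
    nExtra  : ℕ
    start   : Fin nStates
    δ       : Fin nStates → Fin (3 + nExtra) →
              Maybe (Fin nStates × Fin (3 + nExtra) × Move)

module Run (T : TM) where
  open TM T

  Sym : Set
  Sym = Fin (3 + nExtra)

  blank : Sym
  blank = fz

  bitSym : Bool → Sym
  bitSym false = fs fz
  bitSym true  = fs (fs fz)

  -- state, tape left of the head (nearest first), scanned symbol,
  -- tape right of the head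
  record Config : Set where
    constructor cfg
    field
      state : Fin nStates
      lft   : List Sym
      hd    : Sym
      rgt   : List Sym

  move : Move → Config → Config
  move left  (cfg q [] h r)       = cfg q [] blank (h ∷ r)
  move left  (cfg q (l ∷ ls) h r) = cfg q ls l (h ∷ r)
  move right (cfg q l h [])       = cfg q (h ∷ l) blank []
  move right (cfg q l h (r ∷ rs)) = cfg q (h ∷ l) r rs
  move stay  c                    = c

  step : Config → Maybe Config
  step (cfg q l h r) with δ q h
  ... | nothing            = nothing
  ... | just (q' , a , m)  = just (move m (cfg q' l a r))

  run : ℕ → Config → Config
  run zero c = c
  run (suc t) c with step c
  ... | nothing = c
  ... | just c' = run t c'

  Halted : Config → Set
  Halted c = step c ≡ nothing

  init : List Bool → Config
  init []      = cfg start [] blank []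
  init (b ∷ s) = cfg start [] (bitSym b) (map bitSym s)

  readBits : List Sym → List Bool
  readBits [] = []
  readBits (fz ∷ _) = []
  readBits (fs fz ∷ xs) = false ∷ readBits xs
  readBits (fs (fs fz) ∷ xs) = true ∷ readBits xs
  readBits (fs (fs (fs _)) ∷ _) = []

  output : Config → List Bool
  output (cfg q l h r) = readBits (h ∷ r)

  ComputesInTime : (List Bool → List Bool) → (ℕ → ℕ) → Set
  ComputesInTime f bound = (s : List Bool) →
    Halted (run (bound (length s)) (init s)) ×
    output (run (bound (length s)) (init s)) ≡ f s

tower : ℕ → ℕ → ℕ
tower zero n    = n
tower (suc h) n = 2 ^ tower h n

PolyTimeComputable : (List Bool → List Bool) → Set
PolyTimeComputable f =
  Σ TM (λ M → Σ ℕ (λ c → Σ ℕ (λ k →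
    Run.ComputesInTime M f (λ n → (n + c) ^ k))))

ElementaryTimeComputable : (List Bool → List Bool) → Set
ElementaryTimeComputable f =
  Σ TM (λ M → Σ ℕ (λ h → Σ ℕ (λ c →
    Run.ComputesInTime M f (λ n → tower h (n + c)))))

-- A configuration of the machine is a tree in 𝔻¹ (numerals for the state and the scanned
-- symbol, lists for the two halves of the tape), and one machine step is a closed term
-- 𝔻¹ ⊸ 𝔻¹ built from conditionals alone.  Halted configurations are fixed points of the step,
-- so iterating it more often than the running time does no harm.  The input s can be read
-- only once, so a single recursion over s writes it onto the tape and, since each branch also
-- receives the tail t of the input, runs a clock on every tail: a term 𝔹^L ⊸ 𝔻¹ ⊸ 𝔻¹ that
-- iterates the step.  Without contraction, nested recursions on 𝔹² give clocks with
-- iterated-sum running times, which dominate (n + c)^k.  With contraction on ℂ^j, a recursion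
-- on a ℂ-tree with ℓ leaves produces a tree with 2^ℓ leaves, and h such exponentiations give
-- clocks of length tower h.

{-# OPTIONS --safe #-}
module Submission where

open import Defs
open import Data.Nat using (ℕ; zero; suc; _+_; _*_; _^_; _∸_; _≤_; _<_; _≤ᵇ_; _!; s≤s; z≤n; _≟_)
open import Data.Nat.Properties
open import Data.Nat.GeneralisedArithmetic using (fold; fold-+; iterate; iterate-is-fold)
open import Data.Nat.Tactic.RingSolver using (solve-∀)
open import Data.Bool using (Bool; true; false; if_then_else_)
open import Data.Fin using (Fin; toℕ) renaming (zero to fz; suc to fs)
open import Data.List using (List; []; _∷_; _++_; map; length; replicate)
open import Data.List.Properties using (++-identityʳ; length-++; length-replicate)
open import Data.Maybe using (Maybe; just; nothing)
open import Data.Product using (Σ; _×_; _,_; proj₁; proj₂)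
open import Data.Unit using (⊤)
open import Data.Empty using (⊥-elim)
open import Data.List.Membership.DecPropositional _≟_ using (_∈?_; _∉?_)
open import Data.List.Membership.Propositional using (_∉_)
open import Data.List.Relation.Unary.Any using (here; there)
open import Data.List.Relation.Unary.All using ([])
open import Data.List.Relation.Unary.Unique.DecPropositional _≟_ using (unique?)
open import Data.List.Relation.Binary.Permutation.Propositional
  using (_↭_; ↭-refl; ↭-reflexive; ↭-sym; ↭-trans; prep; swap)
open import Relation.Nullary using (yes; no)
open import Relation.Nullary.Decidable using (True; toWitness)
open import Function using (_∘_)
open import Relation.Binary.PropositionalEquality
  using (_≡_; refl; sym; trans; cong; cong₂; module ≡-Reasoning)
open import Relation.Binary.Construct.Closure.ReflexiveTransitive using (ε; _◅_; _◅◅_; gmap)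

data 𝔻Tree : Set where
  lf    : 𝔻Tree
  n₁ n₂ : 𝔻Tree → 𝔻Tree → 𝔻Tree

data ℂTree : Set where
  leaf : ℂTree
  node : ℂTree → ℂTree → ℂTree

leaves : ℂTree → ℕ
leaves leaf       = 1
leaves (node a b) = leaves a + leaves b

numeral : ℕ → 𝔻Tree
numeral zero    = lf
numeral (suc i) = n₁ lf (numeral i)

select : ∀ {A : Set} k → (Fin k → A) → A → 𝔻Tree → A
select zero    f d x         = d
select (suc k) f d lf        = f fz
select (suc k) f d (n₁ _ x)  = select k (λ i → f (fs i)) d x
select (suc k) f d (n₂ _ _)  = d

select-numeral : ∀ {A : Set} k (f : Fin k → A) d i → select k f d (numeral (toℕ i)) ≡ f i
select-numeral (suc k) f d fz     = refl
select-numeral (suc k) f d (fs i) = select-numeral k (λ j → f (fs j)) d i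

select-preserves : ∀ {A B : Set} (R : A → B → Set) k {f g d e} →
  (∀ i → R (f i) (g i)) → R d e → ∀ x → R (select k f d x) (select k g e x)
select-preserves R zero    fRg dRe x        = dRe
select-preserves R (suc k) fRg dRe lf       = fRg fz
select-preserves R (suc k) fRg dRe (n₁ _ x) = select-preserves R k (λ i → fRg (fs i)) dRe x
select-preserves R (suc k) fRg dRe (n₂ _ _) = dRe

comb : ℕ → ℂTree
comb n = fold leaf (node leaf) n

leaves-comb : ∀ n → leaves (comb n) ≡ suc n
leaves-comb zero    = refl
leaves-comb (suc n) = cong suc (leaves-comb n)

double : ℂTree → ℂTree
double t = node t t

leaves-double : ∀ n → leaves (fold leaf double n) ≡ 2 ^ n
leaves-double zero    = refl
leaves-double (suc n) = cong₂ _+_ (leaves-double n) (trans (leaves-double n) (sym (+-identityʳ (2 ^ n))))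

length-pad : ∀ p (s : List Bool) → length (replicate p false ++ s) ≡ p + length s
length-pad p s = trans (length-++ (replicate p false)) (cong (_+ length s) (length-replicate p))

nestedSum : ℕ → ℕ → ℕ → ℕ
nestedSum E zero    m       = E
nestedSum E (suc d) zero    = nestedSum E d zero
nestedSum E (suc d) (suc m) = nestedSum E (suc d) m + nestedSum E d (suc m)

^-suc-≤ : ∀ b n → suc b ^ suc n ≤ b ^ suc n + suc n * suc b ^ n
^-suc-≤ b zero = ≤-reflexive (base b)
  where
  base : ∀ b → suc b * 1 ≡ b * 1 + 1 * 1
  base = solve-∀
^-suc-≤ b (suc n) = begin
  suc b * (suc b * y)                      ≤⟨ *-monoʳ-≤ (suc b) (^-suc-≤ b n) ⟩
  suc b * (x + suc n * y)                  ≡⟨ expand b x y n ⟩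
  x + b * x + suc n * (suc b * y)          ≤⟨ +-monoˡ-≤ _ (+-monoˡ-≤ (b * x) (^-monoˡ-≤ (suc n) (n≤1+n b))) ⟩
  suc b * y + b * x + suc n * (suc b * y)  ≡⟨ collect b x y n ⟩
  b * x + suc (suc n) * (suc b * y)        ∎
  where
  open ≤-Reasoning
  x = b ^ suc n
  y = suc b ^ n
  expand : ∀ b x y n → suc b * (x + suc n * y) ≡ x + b * x + suc n * (suc b * y)
  expand = solve-∀
  collect : ∀ b x y n → suc b * y + b * x + suc n * (suc b * y) ≡ b * x + suc (suc n) * (suc b * y)
  collect = solve-∀

*-^-≤-!*-nestedSum : ∀ E d m → E * suc m ^ d ≤ d ! * nestedSum E d m
*-^-≤-!*-nestedSum E zero m = ≤-reflexive (*-comm E 1)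
*-^-≤-!*-nestedSum E (suc d) zero = begin
  E * (1 * 1 ^ d)                 ≡⟨ cong (E *_) (*-identityˡ (1 ^ d)) ⟩
  E * 1 ^ d                       ≤⟨ *-^-≤-!*-nestedSum E d zero ⟩
  d ! * nestedSum E d zero        ≤⟨ m≤m+n _ _ ⟩
  suc d * (d ! * nestedSum E d zero) ≡⟨ sym (*-assoc (suc d) (d !) _) ⟩
  suc d ! * nestedSum E d zero    ∎
  where open ≤-Reasoning
*-^-≤-!*-nestedSum E (suc d) (suc m) = begin
  E * suc (suc m) ^ suc d                            ≤⟨ *-monoʳ-≤ E (^-suc-≤ (suc m) d) ⟩
  E * (suc m ^ suc d + suc d * suc (suc m) ^ d)      ≡⟨ distribute E _ _ d ⟩
  E * suc m ^ suc d + suc d * (E * suc (suc m) ^ d)  ≤⟨ +-mono-≤ (*-^-≤-!*-nestedSum E (suc d) m)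
                                                         (*-monoʳ-≤ (suc d) (*-^-≤-!*-nestedSum E d (suc m))) ⟩
  suc d ! * S₁ + suc d * (d ! * S₀)                  ≡⟨ cong (suc d ! * S₁ +_) (sym (*-assoc (suc d) (d !) S₀)) ⟩
  suc d ! * S₁ + suc d ! * S₀                        ≡⟨ sym (*-distribˡ-+ (suc d !) S₁ S₀) ⟩
  suc d ! * nestedSum E (suc d) (suc m)              ∎
  where
  open ≤-Reasoning
  S₁ = nestedSum E (suc d) m
  S₀ = nestedSum E d (suc m)
  distribute : ∀ E u v d → E * (u + suc d * v) ≡ E * u + suc d * (E * v)
  distribute = solve-∀

^-≤-nestedSum : ∀ k {m n} → m ≤ suc n → m ^ k ≤ nestedSum (k !) k n
^-≤-nestedSum k {n = n} m≤1+n =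
  ≤-trans (^-monoˡ-≤ k m≤1+n) (*-cancelˡ-≤ (k !) {{k !≢0}} (*-^-≤-!*-nestedSum (k !) k n))

tower-monoʳ-≤ : ∀ h {m n} → m ≤ n → tower h m ≤ tower h n
tower-monoʳ-≤ zero    m≤n = m≤n
tower-monoʳ-≤ (suc h) m≤n = ^-monoʳ-≤ 2 (tower-monoʳ-≤ h m≤n)

tower-2^ : ∀ h n → tower h (2 ^ n) ≡ tower (suc h) n
tower-2^ zero    n = refl
tower-2^ (suc h) n = cong (2 ^_) (tower-2^ h n)

-- Turing machines

fold-fixed : ∀ {A : Set} (f : A → A) {x} → f x ≡ x → ∀ n → fold x f n ≡ x
fold-fixed f e zero    = refl
fold-fixed f e (suc n) = trans (cong f (fold-fixed f e n)) e

module Machine (M : TM) where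
  open TM M
  open Run M

  stepWith : Fin nStates → List Sym → Sym → List Sym →
             Maybe (Fin nStates × Sym × Move) → Config
  stepWith q l h r nothing            = cfg q l h r
  stepWith q l h r (just (q′ , a , m)) = move m (cfg q′ l a r)

  step′ : Config → Config
  step′ (cfg q l h r) = stepWith q l h r (δ q h)

  ⌜_⌝sym : Sym → 𝔻Tree
  ⌜ a ⌝sym = numeral (toℕ a)

  ⌜_⌝state : Fin nStates → 𝔻Tree
  ⌜ q ⌝state = numeral (toℕ q)

  ⌜_⌝tape : List Sym → 𝔻Tree
  ⌜ [] ⌝tape    = lf
  ⌜ a ∷ l ⌝tape = n₁ ⌜ a ⌝sym ⌜ l ⌝tape

  ⌜_⌝cfg : Config → 𝔻Tree
  ⌜ cfg q l h r ⌝cfg = n₁ (n₁ ⌜ q ⌝state ⌜ h ⌝sym) (n₁ ⌜ l ⌝tape ⌜ r ⌝tape)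

  cellBits : Fin 3 → List Bool → List Bool
  cellBits fz           = λ _ → []
  cellBits (fs fz)      = false ∷_
  cellBits (fs (fs fz)) = true ∷_

  readTape : 𝔻Tree → List Bool
  readTape lf       = []
  readTape (n₁ a l) = select 3 cellBits (λ _ → []) a (readTape l)
  readTape (n₂ _ _) = []

  readTape-⌜⌝ : ∀ l → readTape ⌜ l ⌝tape ≡ readBits l
  readTape-⌜⌝ []                    = refl
  readTape-⌜⌝ (fz ∷ l)              = refl
  readTape-⌜⌝ (fs fz ∷ l)           = cong (false ∷_) (readTape-⌜⌝ l)
  readTape-⌜⌝ (fs (fs fz) ∷ l)      = cong (true ∷_) (readTape-⌜⌝ l)
  readTape-⌜⌝ (fs (fs (fs _)) ∷ l)  = refl

  initFromTape : List Sym → Config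
  initFromTape []      = cfg start [] blank []
  initFromTape (h ∷ r) = cfg start [] h r

  initFromTape-bits : ∀ s → initFromTape (map bitSym s ++ []) ≡ init s
  initFromTape-bits []      = refl
  initFromTape-bits (b ∷ s) = cong (cfg start [] (bitSym b)) (++-identityʳ (map bitSym s))

  step′-halted : ∀ {c} → Halted c → step′ c ≡ c
  step′-halted {cfg q l h r} halted with δ q h
  ... | nothing = refl
  step′-halted {cfg q l h r} () | just _

  step′-step : ∀ {c c′} → step c ≡ just c′ → step′ c ≡ c′
  step′-step {cfg q l h r} e with δ q h
  step′-step {cfg q l h r} refl | just _ = refl
  step′-step {cfg q l h r} () | nothing

  run≡fold : ∀ t c → run t c ≡ fold c step′ t
  run≡fold t c = trans (run≡iterate t c) (sym (iterate-is-fold c step′ t))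
    where
    run≡iterate : ∀ t c → run t c ≡ iterate step′ c t
    run≡iterate zero c = refl
    run≡iterate (suc t) c with step c in eq
    ... | nothing = sym (begin
      iterate step′ (step′ c) t ≡⟨ cong (λ x → iterate step′ x t) (step′-halted eq) ⟩
      iterate step′ c t         ≡⟨ sym (iterate-is-fold c step′ t) ⟩
      fold c step′ t            ≡⟨ fold-fixed step′ (step′-halted eq) t ⟩
      c                         ∎)
      where open ≡-Reasoning
    ... | just c′ = trans (run≡iterate t c′) (cong (λ x → iterate step′ x t) (sym (step′-step eq)))

  fold-step′-halted : ∀ {b t} c → b ≤ t → Halted (run b c) → fold c step′ t ≡ run b c
  fold-step′-halted {b} {t} c b≤t halted = begin
    fold c step′ t                       ≡⟨ cong (fold c step′) (sym (m∸n+n≡m b≤t)) ⟩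
    fold c step′ (t ∸ b + b)             ≡⟨ fold-+ c step′ (t ∸ b) ⟩
    fold (fold c step′ b) step′ (t ∸ b)  ≡⟨ cong (λ x → fold x step′ (t ∸ b)) (sym (run≡fold b c)) ⟩
    fold (run b c) step′ (t ∸ b)         ≡⟨ fold-fixed step′ (step′-halted halted) (t ∸ b) ⟩
    run b c                              ∎
    where open ≡-Reasoning

-- Terms

module Terms (𝔉 : Family) where
  open Lang 𝔉 public

  ⌜_⌝𝔻 : 𝔻Tree → Tm
  ⌜ lf ⌝𝔻     = con (𝔻 , fs (fs fz))
  ⌜ n₁ a b ⌝𝔻 = con (𝔻 , fz) · ⌜ a ⌝𝔻 · ⌜ b ⌝𝔻
  ⌜ n₂ a b ⌝𝔻 = con (𝔻 , fs fz) · ⌜ a ⌝𝔻 · ⌜ b ⌝𝔻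

  ⌜_⌝ℂ : ℂTree → Tm
  ⌜ leaf ⌝ℂ     = con (ℂ , fs fz)
  ⌜ node a b ⌝ℂ = con (ℂ , fz) · ⌜ a ⌝ℂ · ⌜ b ⌝ℂ

  ⌜⌝𝔻-ct : ∀ d → IsCT ⌜ d ⌝𝔻
  ⌜⌝𝔻-ct lf       = ctCon
  ⌜⌝𝔻-ct (n₁ a b) = ctApp (ctApp ctCon (⌜⌝𝔻-ct a)) (⌜⌝𝔻-ct b)
  ⌜⌝𝔻-ct (n₂ a b) = ctApp (ctApp ctCon (⌜⌝𝔻-ct a)) (⌜⌝𝔻-ct b)

  ⌜⌝ℂ-ct : ∀ t → IsCT ⌜ t ⌝ℂ
  ⌜⌝ℂ-ct leaf       = ctCon
  ⌜⌝ℂ-ct (node a b) = ctApp (ctApp ctCon (⌜⌝ℂ-ct a)) (⌜⌝ℂ-ct b)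

  encode-ct : ∀ s → IsCT (encode s)
  encode-ct []          = ctCon
  encode-ct (false ∷ s) = ctApp ctCon (encode-ct s)
  encode-ct (true ∷ s)  = ctApp ctCon (encode-ct s)

  Closed : Tm → Set
  Closed M = ∀ x N → subst M x N ≡ M

  ⌜⌝𝔻-closed : ∀ d → Closed ⌜ d ⌝𝔻
  ⌜⌝𝔻-closed lf       x N = refl
  ⌜⌝𝔻-closed (n₁ a b) x N = cong₂ (λ u v → con _ · u · v) (⌜⌝𝔻-closed a x N) (⌜⌝𝔻-closed b x N)
  ⌜⌝𝔻-closed (n₂ a b) x N = cong₂ (λ u v → con _ · u · v) (⌜⌝𝔻-closed a x N) (⌜⌝𝔻-closed b x N)

  ⌜⌝ℂ-closed : ∀ t → Closed ⌜ t ⌝ℂ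
  ⌜⌝ℂ-closed leaf       x N = refl
  ⌜⌝ℂ-closed (node a b) x N = cong₂ (λ u v → con _ · u · v) (⌜⌝ℂ-closed a x N) (⌜⌝ℂ-closed b x N)

  encode-closed : ∀ s → Closed (encode s)
  encode-closed []          x N = refl
  encode-closed (false ∷ s) x N = cong (con _ ·_) (encode-closed s x N)
  encode-closed (true ∷ s)  x N = cong (con _ ·_) (encode-closed s x N)

  -- Terms whose closed constituents are kept abstract, so that substitution
  -- into them is computed by substT and never has to look inside a constant.
  infixl 7 _∙_
  infixr 6 ƛ_⇒_
  data Template : Set where
    tvar       : Var → Template
    tconst     : (M : Tm) → Closed M → Template
    t𝔻         : 𝔻Tree → Template
    t𝔹         : List Bool → Template
    tℂ         : ℂTree → Template
    _∙_        : Template → Template → Template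
    ƛ_⇒_       : Var → Template → Template
    tcond trec : Template → List Template → Template

  mutual
    fill : Template → Tm
    fill (tvar x)     = var x
    fill (tconst M _) = M
    fill (t𝔻 d)       = ⌜ d ⌝𝔻
    fill (t𝔹 s)       = encode s
    fill (tℂ t)       = ⌜ t ⌝ℂ
    fill (t ∙ u)      = fill t · fill u
    fill (ƛ x ⇒ t)    = lam x (fill t)
    fill (tcond t ts) = cond (fill t) (fills ts)
    fill (trec t ts)  = rec (fill t) (fills ts)

    fills : List Template → List Tm
    fills []       = []
    fills (t ∷ ts) = fill t ∷ fills ts

  mutual
    substT : Template → Var → Template → Template
    substT (tvar y) x u with x ≟ y
    ... | yes _ = u
    ... | no  _ = tvar y
    substT (t ∙ t′) x u = substT t x u ∙ substT t′ x u
    substT (ƛ y ⇒ t) x u with x ≟ y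
    ... | yes _ = ƛ y ⇒ t
    ... | no  _ = ƛ y ⇒ substT t x u
    substT (tcond t ts) x u = tcond (substT t x u) (substTs ts x u)
    substT (trec t ts)  x u = trec (substT t x u) (substTs ts x u)
    substT t x u = t

    substTs : List Template → Var → Template → List Template
    substTs []       x u = []
    substTs (t ∷ ts) x u = substT t x u ∷ substTs ts x u

  mutual
    subst-fill : ∀ t x u → subst (fill t) x (fill u) ≡ fill (substT t x u)
    subst-fill (tvar y) x u with x ≟ y
    ... | yes _ = refl
    ... | no  _ = refl
    subst-fill (tconst M c) x u = c x (fill u)
    subst-fill (t𝔻 d) x u = ⌜⌝𝔻-closed d x (fill u)
    subst-fill (t𝔹 s) x u = encode-closed s x (fill u)
    subst-fill (tℂ t) x u = ⌜⌝ℂ-closed t x (fill u)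
    subst-fill (t ∙ t′) x u = cong₂ _·_ (subst-fill t x u) (subst-fill t′ x u)
    subst-fill (ƛ y ⇒ t) x u with x ≟ y
    ... | yes _ = refl
    ... | no  _ = cong (lam y) (subst-fill t x u)
    subst-fill (tcond t ts) x u = cong₂ cond (subst-fill t x u) (subst-fills ts x u)
    subst-fill (trec t ts)  x u = cong₂ rec (subst-fill t x u) (subst-fills ts x u)

    subst-fills : ∀ ts x u → substs (fills ts) x (fill u) ≡ fills (substTs ts x u)
    subst-fills []       x u = refl
    subst-fills (t ∷ ts) x u = cong₂ _∷_ (subst-fill t x u) (subst-fills ts x u)

  mutual
    ClosedIn : List Var → Template → Set
    ClosedIn bs (tvar y)     = True (y ∈? bs)
    ClosedIn bs (t ∙ u)      = ClosedIn bs t × ClosedIn bs u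
    ClosedIn bs (ƛ y ⇒ t)    = ClosedIn (y ∷ bs) t
    ClosedIn bs (tcond t ts) = ClosedIn bs t × AllClosedIn bs ts
    ClosedIn bs (trec t ts)  = ClosedIn bs t × AllClosedIn bs ts
    ClosedIn bs _            = ⊤

    AllClosedIn : List Var → List Template → Set
    AllClosedIn bs []       = ⊤
    AllClosedIn bs (t ∷ ts) = ClosedIn bs t × AllClosedIn bs ts

  mutual
    subst-fill-fresh : ∀ {bs x} t → ClosedIn bs t → x ∉ bs → ∀ N → subst (fill t) x N ≡ fill t
    subst-fill-fresh {x = x} (tvar y) y∈bs x∉bs N with x ≟ y
    ... | yes refl = ⊥-elim (x∉bs (toWitness y∈bs))
    ... | no  _    = refl
    subst-fill-fresh (tconst M c) _ _ N = c _ N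
    subst-fill-fresh (t𝔻 d) _ _ N = ⌜⌝𝔻-closed d _ N
    subst-fill-fresh (t𝔹 s) _ _ N = encode-closed s _ N
    subst-fill-fresh (tℂ t) _ _ N = ⌜⌝ℂ-closed t _ N
    subst-fill-fresh (t ∙ u) (ct , cu) x∉bs N =
      cong₂ _·_ (subst-fill-fresh t ct x∉bs N) (subst-fill-fresh u cu x∉bs N)
    subst-fill-fresh {x = x} (ƛ y ⇒ t) ct x∉bs N with x ≟ y
    ... | yes _   = refl
    ... | no  x≢y = cong (lam y) (subst-fill-fresh t ct x∉y∷bs N)
      where
      x∉y∷bs = λ { (here x≡y) → x≢y x≡y ; (there x∈bs) → x∉bs x∈bs }
    subst-fill-fresh (tcond t ts) (ct , cts) x∉bs N =
      cong₂ cond (subst-fill-fresh t ct x∉bs N) (subst-fills-fresh ts cts x∉bs N)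
    subst-fill-fresh (trec t ts) (ct , cts) x∉bs N =
      cong₂ rec (subst-fill-fresh t ct x∉bs N) (subst-fills-fresh ts cts x∉bs N)

    subst-fills-fresh : ∀ {bs x} ts → AllClosedIn bs ts → x ∉ bs → ∀ N → substs (fills ts) x N ≡ fills ts
    subst-fills-fresh []       _          _    N = refl
    subst-fills-fresh (t ∷ ts) (ct , cts) x∉bs N =
      cong₂ _∷_ (subst-fill-fresh t ct x∉bs N) (subst-fills-fresh ts cts x∉bs N)

  closed : (t : Template) {ct : ClosedIn [] t} → Closed (fill t)
  closed t {ct} x = subst-fill-fresh t ct λ ()

  ClosedTemplate : Set
  ClosedTemplate = Σ Template (λ t → Closed (fill t))

  ⟪_⟫ : ClosedTemplate → Template
  ⟪ t , c ⟫ = tconst (fill t) c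

  close : (t : Template) {ct : ClosedIn [] t} → ClosedTemplate
  close t {ct} = t , closed t {ct}

  infix  4 _⇝_
  infixr 5 _▶_

  -- A record, so that t and u can be inferred from a goal t ⇝ u.
  record _⇝_ (t u : Template) : Set where
    constructor ⟨_⟩
    field reduces : fill t ↝* fill u
  open _⇝_ public

  _▶_ : ∀ {t u w} → t ⇝ u → u ⇝ w → t ⇝ w
  ⟨ p ⟩ ▶ ⟨ q ⟩ = ⟨ p ◅◅ q ⟩

  ≡⇒↝* : ∀ {M N} → M ≡ N → M ↝* N
  ≡⇒↝* refl = ε

  same-term : ∀ {t u} → fill t ≡ fill u → t ⇝ u
  same-term e = ⟨ ≡⇒↝* e ⟩

  unfold : ∀ c → ⟪ c ⟫ ⇝ proj₁ c
  unfold c = ⟨ ε ⟩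

  ∙L : ∀ {t t′ u} → t ⇝ t′ → t ∙ u ⇝ t′ ∙ u
  ∙L ⟨ p ⟩ = ⟨ gmap _ appL p ⟩

  ∙R : ∀ {t u u′} → u ⇝ u′ → t ∙ u ⇝ t ∙ u′
  ∙R ⟨ p ⟩ = ⟨ gmap _ appR p ⟩

  by-rule : ∀ {t u} → fill t ⟶ fill u → t ⇝ u
  by-rule r = ⟨ top r ◅ ε ⟩

  βv : ∀ {x t} u → Value (fill u) → (ƛ x ⇒ t) ∙ u ⇝ substT t x u
  βv {x} {t} u v = ⟨ top (β v) ◅ ≡⇒↝* (subst-fill t x u) ⟩

  β𝔻 : ∀ {x t d} → (ƛ x ⇒ t) ∙ t𝔻 d ⇝ substT t x (t𝔻 d)
  β𝔻 {d = d} = βv (t𝔻 d) (vCT (⌜⌝𝔻-ct d))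

  β𝔹 : ∀ {x t s} → (ƛ x ⇒ t) ∙ t𝔹 s ⇝ substT t x (t𝔹 s)
  β𝔹 {s = s} = βv (t𝔹 s) (vCT (encode-ct s))

  βℂ : ∀ {x t T} → (ƛ x ⇒ t) ∙ tℂ T ⇝ substT t x (tℂ T)
  βℂ {T = T} = βv (tℂ T) (vCT (⌜⌝ℂ-ct T))

  βconst : ∀ {x t M c} → Value M → (ƛ x ⇒ t) ∙ tconst M c ⇝ substT t x (tconst M c)
  βconst {M = M} {c} v = βv (tconst M c) v

  record Evaluates (t : Template) (P : ClosedTemplate → Set) : Set where
    field
      result       : ClosedTemplate
      evaluates    : t ⇝ ⟪ result ⟫
      result-value : Value (fill (proj₁ result))
      result-has   : P result
  open Evaluates public

  module _ {a b : 𝔻Tree} {m₁ m₂ m₃ : Template} where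
    cond-n₁ : tcond (t𝔻 (n₁ a b)) (m₁ ∷ m₂ ∷ m₃ ∷ []) ⇝ m₁ ∙ t𝔻 a ∙ t𝔻 b
    cond-n₁ = by-rule (ιc (spApp (spApp spCon (⌜⌝𝔻-ct a)) (⌜⌝𝔻-ct b)) refl here)

    cond-n₂ : tcond (t𝔻 (n₂ a b)) (m₁ ∷ m₂ ∷ m₃ ∷ []) ⇝ m₂ ∙ t𝔻 a ∙ t𝔻 b
    cond-n₂ = by-rule (ιc (spApp (spApp spCon (⌜⌝𝔻-ct a)) (⌜⌝𝔻-ct b)) refl (there here))

    rec-n₁ : let ms = m₁ ∷ m₂ ∷ m₃ ∷ [] in
             trec (t𝔻 (n₁ a b)) ms ⇝ m₁ ∙ t𝔻 a ∙ t𝔻 b ∙ trec (t𝔻 a) ms ∙ trec (t𝔻 b) ms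
    rec-n₁ = by-rule (ιr (spApp (spApp spCon (⌜⌝𝔻-ct a)) (⌜⌝𝔻-ct b)) refl here)

    rec-n₂ : let ms = m₁ ∷ m₂ ∷ m₃ ∷ [] in
             trec (t𝔻 (n₂ a b)) ms ⇝ m₂ ∙ t𝔻 a ∙ t𝔻 b ∙ trec (t𝔻 a) ms ∙ trec (t𝔻 b) ms
    rec-n₂ = by-rule (ιr (spApp (spApp spCon (⌜⌝𝔻-ct a)) (⌜⌝𝔻-ct b)) refl (there here))

  module _ {m₁ m₂ m₃ : Template} where
    cond-lf : tcond (t𝔻 lf) (m₁ ∷ m₂ ∷ m₃ ∷ []) ⇝ m₃
    cond-lf = by-rule (ιc spCon refl (there (there here)))

    rec-lf : trec (t𝔻 lf) (m₁ ∷ m₂ ∷ m₃ ∷ []) ⇝ m₃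
    rec-lf = by-rule (ιr spCon refl (there (there here)))

    rec-[] : trec (t𝔹 []) (m₁ ∷ m₂ ∷ m₃ ∷ []) ⇝ m₃
    rec-[] = by-rule (ιr spCon refl (there (there here)))

  module _ {s : List Bool} {m₁ m₂ m₃ : Template} where
    rec-0∷ : let ms = m₁ ∷ m₂ ∷ m₃ ∷ [] in trec (t𝔹 (false ∷ s)) ms ⇝ m₁ ∙ t𝔹 s ∙ trec (t𝔹 s) ms
    rec-0∷ = by-rule (ιr (spApp spCon (encode-ct s)) refl here)

    rec-1∷ : let ms = m₁ ∷ m₂ ∷ m₃ ∷ [] in trec (t𝔹 (true ∷ s)) ms ⇝ m₂ ∙ t𝔹 s ∙ trec (t𝔹 s) ms
    rec-1∷ = by-rule (ιr (spApp spCon (encode-ct s)) refl (there here))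

  rec-∷ : ∀ b {s} (m : Bool → Template) {m₃} → let ms = m false ∷ m true ∷ m₃ ∷ [] in
          trec (t𝔹 (b ∷ s)) ms ⇝ m b ∙ t𝔹 s ∙ trec (t𝔹 s) ms
  rec-∷ false m = rec-0∷
  rec-∷ true  m = rec-1∷

  module _ {m₁ m₂ : Template} where
    rec-node : ∀ {a b} → let ms = m₁ ∷ m₂ ∷ [] in
               trec (tℂ (node a b)) ms ⇝ m₁ ∙ tℂ a ∙ tℂ b ∙ trec (tℂ a) ms ∙ trec (tℂ b) ms
    rec-node {a} {b} = by-rule (ιr (spApp (spApp spCon (⌜⌝ℂ-ct a)) (⌜⌝ℂ-ct b)) refl here)

    rec-leaf : trec (tℂ leaf) (m₁ ∷ m₂ ∷ []) ⇝ m₂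
    rec-leaf = by-rule (ιr spCon refl (there here))

  module _ {𝖣 : Ty → Set} where
    app : ∀ {Γ Δ M N A B} → RH 𝖣 Γ M (A ⊸ B) → RH 𝖣 Δ N A →
          {True (unique? (dom (Γ ++ Δ)))} → RH 𝖣 (Γ ++ Δ) (M · N) B
    app d e {u} = appE d e (toWitness u)

    weaken : ∀ {Γ M B x A} → RH 𝖣 Γ M B → {True (x ∉? dom Γ)} → RH 𝖣 ((x , A) ∷ Γ) M B
    weaken d {p} = weak d (toWitness p)

    contract : ∀ {Γ M B x y z A} → 𝖣 A → RH 𝖣 ((x , A) ∷ (y , A) ∷ Γ) M B →
               {True (z ∉? dom Γ)} → {True (z ∉? boundVars M)} →
               RH 𝖣 ((z , A) ∷ Γ) (subst (subst M x (var z)) y (var z)) B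
    contract a d {p} {q} = contr a d (toWitness p) (toWitness q)

    private
      insert : Var × Ty → Ctx → Ctx
      insert p []       = p ∷ []
      insert p (q ∷ qs) = if proj₁ p ≤ᵇ proj₁ q then p ∷ q ∷ qs else q ∷ insert p qs

      sortByVar : Ctx → Ctx
      sortByVar []       = []
      sortByVar (p ∷ ps) = insert p (sortByVar ps)

      insert-↭ : ∀ p qs → insert p qs ↭ p ∷ qs
      insert-↭ p []       = ↭-refl
      insert-↭ p (q ∷ qs) with proj₁ p ≤ᵇ proj₁ q
      ... | true  = ↭-refl
      ... | false = ↭-trans (prep q (insert-↭ p qs)) (swap q p ↭-refl)

      sortByVar-↭ : ∀ Γ → sortByVar Γ ↭ Γ
      sortByVar-↭ []       = ↭-refl
      sortByVar-↭ (p ∷ ps) = ↭-trans (insert-↭ p (sortByVar ps)) (prep p (sortByVar-↭ ps))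

    -- Exchange, with the permutation found by sorting both contexts.
    reorder : ∀ {Γ Δ M B} → RH 𝖣 Γ M B → sortByVar Γ ≡ sortByVar Δ → RH 𝖣 Δ M B
    reorder {Γ} {Δ} d e =
      exch (↭-trans (↭-sym (sortByVar-↭ Γ)) (↭-trans (↭-reflexive e) (sortByVar-↭ Δ))) d

    ⌜⌝𝔻-typed : ∀ m d → RH 𝖣 [] ⌜ d ⌝𝔻 (base 𝔻 m)
    ⌜⌝𝔻-typed m lf       = conI _ m
    ⌜⌝𝔻-typed m (n₁ a b) = app (app (conI _ m) (⌜⌝𝔻-typed m a)) (⌜⌝𝔻-typed m b)
    ⌜⌝𝔻-typed m (n₂ a b) = app (app (conI _ m) (⌜⌝𝔻-typed m a)) (⌜⌝𝔻-typed m b)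

    module _ {Δ : Ctx} {L : Tm} {C : Ty} (m : ℕ) {M₁ M₂ M₃ : Tm} where
      cond𝔻 : RH 𝖣 [] M₁ (base 𝔻 m ⊸ base 𝔻 m ⊸ C) → RH 𝖣 [] M₂ (base 𝔻 m ⊸ base 𝔻 m ⊸ C) →
              RH 𝖣 [] M₃ C → RH 𝖣 Δ L (base 𝔻 m) → {True (unique? (dom Δ))} →
              RH 𝖣 Δ (cond L (M₁ ∷ M₂ ∷ M₃ ∷ [])) C
      cond𝔻 d₁ d₂ d₃ dL {u} =
        condE 𝔻 m (λ _ → []) (λ { fz → M₁ ; (fs fz) → M₂ ; (fs (fs fz)) → M₃ })
          (λ { fz → d₁ ; (fs fz) → d₂ ; (fs (fs fz)) → d₃ }) dL (toWitness u)

      rec𝔻 : RH 𝖣 [] M₁ (base 𝔻 m ⊸ base 𝔻 m ⊸ C ⊸ C ⊸ C) →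
             RH 𝖣 [] M₂ (base 𝔻 m ⊸ base 𝔻 m ⊸ C ⊸ C ⊸ C) →
             RH 𝖣 [] M₃ C → level C < m → RH 𝖣 Δ L (base 𝔻 m) → {True (unique? (dom Δ))} →
             RH 𝖣 Δ (rec L (M₁ ∷ M₂ ∷ M₃ ∷ [])) C
      rec𝔻 d₁ d₂ d₃ lv dL {u} =
        recE 𝔻 m (λ _ → []) (λ { fz → M₁ ; (fs fz) → M₂ ; (fs (fs fz)) → M₃ })
          (λ { fz → d₁ ; (fs fz) → d₂ ; (fs (fs fz)) → d₃ }) (λ _ → []) lv dL (toWitness u)

      rec𝔹 : RH 𝖣 [] M₁ (base 𝔹 m ⊸ C ⊸ C) → RH 𝖣 [] M₂ (base 𝔹 m ⊸ C ⊸ C) →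
             RH 𝖣 [] M₃ C → level C < m → RH 𝖣 Δ L (base 𝔹 m) → {True (unique? (dom Δ))} →
             RH 𝖣 Δ (rec L (M₁ ∷ M₂ ∷ M₃ ∷ [])) C
      rec𝔹 d₁ d₂ d₃ lv dL {u} =
        recE 𝔹 m (λ _ → []) (λ { fz → M₁ ; (fs fz) → M₂ ; (fs (fs fz)) → M₃ })
          (λ { fz → d₁ ; (fs fz) → d₂ ; (fs (fs fz)) → d₃ }) (λ _ → []) lv dL (toWitness u)

    recℂ : ∀ {Δ L C} m {M₁ M₂} → RH 𝖣 [] M₁ (base ℂ m ⊸ base ℂ m ⊸ C ⊸ C ⊸ C) →
           RH 𝖣 [] M₂ C → level C < m → RH 𝖣 Δ L (base ℂ m) → {True (unique? (dom Δ))} →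
           RH 𝖣 Δ (rec L (M₁ ∷ M₂ ∷ [])) C
    recℂ m {M₁} {M₂} d₁ d₂ lv dL {u} =
      recE ℂ m (λ _ → []) (λ { fz → M₁ ; (fs fz) → M₂ })
        (λ { fz → d₁ ; (fs fz) → d₂ }) (λ _ → []) lv dL (toWitness u)

  switch : (k : ℕ) → (Fin k → ClosedTemplate) → ClosedTemplate → ClosedTemplate
  switch zero    f d = close (ƛ 0 ⇒ ⟪ d ⟫)
  switch (suc k) f d = close (ƛ 0 ⇒ tcond (tvar 0)
    ( (ƛ 1 ⇒ ƛ 2 ⇒ ⟪ switch k (λ i → f (fs i)) d ⟫ ∙ tvar 2)
    ∷ (ƛ 1 ⇒ ƛ 2 ⇒ ⟪ d ⟫)
    ∷ ⟪ f fz ⟫ ∷ []))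

  switch-select : ∀ k f d x → ⟪ switch k f d ⟫ ∙ t𝔻 x ⇝ ⟪ select k f d x ⟫
  switch-select k f d x = ∙L (unfold (switch k f d)) ▶ reduce k x
    where
    reduce : ∀ k {f d} x → proj₁ (switch k f d) ∙ t𝔻 x ⇝ ⟪ select k f d x ⟫
    reduce zero    x        = β𝔻
    reduce (suc k) lf       = β𝔻 ▶ cond-lf
    reduce (suc k) (n₁ a x) = β𝔻 ▶ cond-n₁ ▶ ∙L β𝔻 ▶ β𝔻 ▶ switch-select k _ _ x
    reduce (suc k) (n₂ a x) = β𝔻 ▶ cond-n₂ ▶ ∙L β𝔻 ▶ β𝔻

  switch-numeral : ∀ k f d i → ⟪ switch k f d ⟫ ∙ t𝔻 (numeral (toℕ i)) ⇝ ⟪ f i ⟫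
  switch-numeral k f d i =
    switch-select k f d (numeral (toℕ i)) ▶ same-term (cong (fill ∘ ⟪_⟫) (select-numeral k f d i))

  switch-typed : ∀ {𝖣} m k f d {C} → (∀ i → RH 𝖣 [] (fill (proj₁ (f i))) C) →
                 RH 𝖣 [] (fill (proj₁ d)) C → RH 𝖣 [] (fill (proj₁ (switch k f d))) (base 𝔻 m ⊸ C)
  switch-typed m zero    f d df dd = lamI (weaken dd)
  switch-typed m (suc k) f d df dd = lamI (cond𝔻 m
    (lamI (lamI (reorder (weaken {x = 1} {A = base 𝔻 m}
      (app (switch-typed m k (λ i → f (fs i)) d (λ i → df (fs i)) dd) ax)) refl)))
    (lamI (lamI (weaken (weaken dd))))
    (df fz) ax)


  cons𝔹 : Bool → Template
  cons𝔹 b = tconst (con (𝔹 , (if b then fs fz else fz))) (λ _ _ → refl)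

  cons𝔹-encode : ∀ b s → fill (cons𝔹 b ∙ t𝔹 s) ≡ encode (b ∷ s)
  cons𝔹-encode false s = refl
  cons𝔹-encode true  s = refl

  padTerm : ℕ → ClosedTemplate
  padTerm zero    = close (ƛ 0 ⇒ tvar 0)
  padTerm (suc p) = close (ƛ 0 ⇒ cons𝔹 false ∙ (⟪ padTerm p ⟫ ∙ tvar 0))

  padTerm-sem : ∀ p s → ⟪ padTerm p ⟫ ∙ t𝔹 s ⇝ t𝔹 (replicate p false ++ s)
  padTerm-sem zero    s = ∙L (unfold (padTerm zero)) ▶ β𝔹
  padTerm-sem (suc p) s = ∙L (unfold (padTerm (suc p))) ▶ β𝔹 ▶ ∙R (padTerm-sem p s) ▶ same-term refl

  cons𝔹-typed : ∀ {𝖣} b L → RH 𝖣 [] (fill (cons𝔹 b)) (base 𝔹 L ⊸ base 𝔹 L)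
  cons𝔹-typed false L = conI _ L
  cons𝔹-typed true  L = conI _ L

  padTerm-typed : ∀ {𝖣} L p → RH 𝖣 [] (fill (proj₁ (padTerm p))) (base 𝔹 L ⊸ base 𝔹 L)
  padTerm-typed L zero    = lamI ax
  padTerm-typed L (suc p) = lamI (app (conI _ L) (app (padTerm-typed L p) ax))

  composeNode : Template
  composeNode = ƛ 1 ⇒ ƛ 2 ⇒ ƛ 3 ⇒ ƛ 4 ⇒ ƛ 5 ⇒ tvar 3 ∙ (tvar 4 ∙ tvar 5)

  composeNode-typed : ∀ {𝖣} m {A} → RH 𝖣 [] (fill composeNode)
    (base ℂ m ⊸ base ℂ m ⊸ (A ⊸ A) ⊸ (A ⊸ A) ⊸ (A ⊸ A))
  composeNode-typed m = lamI (lamI (lamI (lamI (lamI (reorder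
    (weaken {x = 1} {A = base ℂ m} (weaken {x = 2} {A = base ℂ m} (app ax (app ax ax)))) refl)))))

  module TreeIteration {A : Set} (⌜_⌝ : A → Template) (⌜⌝-value : ∀ a → Value (fill ⌜ a ⌝))
                       (f : A → A) (F : ClosedTemplate) (F-value : Value (fill (proj₁ F)))
                       (F-sem : ∀ a → ⟪ F ⟫ ∙ ⌜ a ⌝ ⇝ ⌜ f a ⌝) where
    iterationBranches : List Template
    iterationBranches = composeNode ∷ ⟪ F ⟫ ∷ []

    Iterates : ℂTree → ClosedTemplate → Set
    Iterates T W = ∀ a → ⟪ W ⟫ ∙ ⌜ a ⌝ ⇝ ⌜ fold a f (leaves T) ⌝

    iterate-rec : ∀ T → Evaluates (trec (tℂ T) iterationBranches) (Iterates T)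
    iterate-rec leaf = record
      { result = F ; evaluates = rec-leaf ; result-value = F-value ; result-has = F-sem }
    iterate-rec (node T U) = record
      { result = W ; evaluates = evaluation ; result-value = vLam ; result-has = iterates }
      where
      W = close (ƛ 5 ⇒ ⟪ result (iterate-rec T) ⟫ ∙ (⟪ result (iterate-rec U) ⟫ ∙ tvar 5))

      evaluation : trec (tℂ (node T U)) iterationBranches ⇝ ⟪ W ⟫
      evaluation =
        rec-node ▶ ∙L (∙R (evaluates (iterate-rec T))) ▶ ∙R (evaluates (iterate-rec U)) ▶
        ∙L (∙L (∙L βℂ)) ▶ ∙L (∙L βℂ) ▶ ∙L (βconst (result-value (iterate-rec T))) ▶
        βconst (result-value (iterate-rec U)) ▶ same-term refl

      iterates : Iterates (node T U) W
      iterates a =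
        ∙L (unfold W) ▶ βv ⌜ a ⌝ (⌜⌝-value a) ▶ ∙R (result-has (iterate-rec U) a) ▶
        result-has (iterate-rec T) _ ▶ same-term (cong (fill ∘ ⌜_⌝) (sym (fold-+ a f (leaves T))))

-- Simulation of a machine

module Simulation (𝔉 : Family) (M : TM) where
  open Terms 𝔉
  open TM M
  open Run M
  open Machine M

  𝔻¹ : Ty
  𝔻¹ = base 𝔻 1

  pair : Template → Template → Template
  pair a b = tconst (con (𝔻 , fz)) (λ _ _ → refl) ∙ a ∙ b

  -- the result in branches that well-formed encodings never reach
  junk : Template
  junk = t𝔻 lf

  -- In context: 9 ↦ left tape, 10 ↦ right tape.
  moveTerm : Move → Fin nStates → Sym → Template
  moveTerm stay q a = pair (t𝔻 (n₁ ⌜ q ⌝state ⌜ a ⌝sym)) (pair (tvar 9) (tvar 10))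
  moveTerm left q a = tcond (tvar 9)
    ( (ƛ 11 ⇒ ƛ 12 ⇒ ƛ 10 ⇒
        pair (pair (t𝔻 ⌜ q ⌝state) (tvar 11)) (pair (tvar 12) (pair (t𝔻 ⌜ a ⌝sym) (tvar 10))))
    ∷ (ƛ 11 ⇒ ƛ 12 ⇒ ƛ 10 ⇒ junk)
    ∷ (ƛ 10 ⇒ pair (t𝔻 (n₁ ⌜ q ⌝state ⌜ blank ⌝sym)) (pair (t𝔻 lf) (pair (t𝔻 ⌜ a ⌝sym) (tvar 10))))
    ∷ []) ∙ tvar 10
  moveTerm right q a = tcond (tvar 10)
    ( (ƛ 11 ⇒ ƛ 12 ⇒ ƛ 9 ⇒
        pair (pair (t𝔻 ⌜ q ⌝state) (tvar 11)) (pair (pair (t𝔻 ⌜ a ⌝sym) (tvar 9)) (tvar 12)))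
    ∷ (ƛ 11 ⇒ ƛ 12 ⇒ ƛ 9 ⇒ junk)
    ∷ (ƛ 9 ⇒ pair (t𝔻 (n₁ ⌜ q ⌝state ⌜ blank ⌝sym)) (pair (pair (t𝔻 ⌜ a ⌝sym) (tvar 9)) (t𝔻 lf)))
    ∷ []) ∙ tvar 9

  transitionTerm : Fin nStates → Sym → Maybe (Fin nStates × Sym × Move) → ClosedTemplate
  transitionTerm q h nothing = close (ƛ 8 ⇒ pair (t𝔻 (n₁ ⌜ q ⌝state ⌜ h ⌝sym)) (tvar 8))
  transitionTerm q h (just (q′ , a , stay))  = close (ƛ 8 ⇒ tcond (tvar 8)
    ((ƛ 9 ⇒ ƛ 10 ⇒ moveTerm stay q′ a) ∷ (ƛ 9 ⇒ ƛ 10 ⇒ junk) ∷ junk ∷ []))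
  transitionTerm q h (just (q′ , a , left))  = close (ƛ 8 ⇒ tcond (tvar 8)
    ((ƛ 9 ⇒ ƛ 10 ⇒ moveTerm left q′ a) ∷ (ƛ 9 ⇒ ƛ 10 ⇒ junk) ∷ junk ∷ []))
  transitionTerm q h (just (q′ , a , right)) = close (ƛ 8 ⇒ tcond (tvar 8)
    ((ƛ 9 ⇒ ƛ 10 ⇒ moveTerm right q′ a) ∷ (ƛ 9 ⇒ ƛ 10 ⇒ junk) ∷ junk ∷ []))

  transitionTerm-sem : ∀ q h δqh l r →
    proj₁ (transitionTerm q h δqh) ∙ t𝔻 (n₁ ⌜ l ⌝tape ⌜ r ⌝tape) ⇝ t𝔻 ⌜ stepWith q l h r δqh ⌝cfg
  transitionTerm-sem q h nothing l r = β𝔻 ▶ same-term refl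
  transitionTerm-sem q h (just (_ , _ , stay)) l r =
    β𝔻 ▶ cond-n₁ ▶ ∙L β𝔻 ▶ β𝔻 ▶ same-term refl
  transitionTerm-sem q h (just (_ , _ , left)) [] r =
    β𝔻 ▶ cond-n₁ ▶ ∙L β𝔻 ▶ β𝔻 ▶
    ∙L cond-lf ▶ β𝔻 ▶ same-term refl
  transitionTerm-sem q h (just (_ , _ , left)) (x ∷ l) r =
    β𝔻 ▶ cond-n₁ ▶ ∙L β𝔻 ▶ β𝔻 ▶
    ∙L cond-n₁ ▶ ∙L (∙L β𝔻) ▶ ∙L β𝔻 ▶ β𝔻 ▶ same-term refl
  transitionTerm-sem q h (just (_ , _ , right)) l [] =
    β𝔻 ▶ cond-n₁ ▶ ∙L β𝔻 ▶ β𝔻 ▶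
    ∙L cond-lf ▶ β𝔻 ▶ same-term refl
  transitionTerm-sem q h (just (_ , _ , right)) l (x ∷ r) =
    β𝔻 ▶ cond-n₁ ▶ ∙L β𝔻 ▶ β𝔻 ▶
    ∙L cond-n₁ ▶ ∙L (∙L β𝔻) ▶ ∙L β𝔻 ▶ β𝔻 ▶ same-term refl

  transition : Fin nStates → Sym → ClosedTemplate
  transition q h = transitionTerm q h (δ q h)

  dispatchSymbol : Fin nStates → ClosedTemplate
  dispatchSymbol q = switch (3 + nExtra) (transition q) (close (ƛ 8 ⇒ junk))

  dispatch : ClosedTemplate
  dispatch = switch nStates dispatchSymbol (close (ƛ 7 ⇒ ƛ 8 ⇒ junk))

  stepTerm : ClosedTemplate
  stepTerm = close (ƛ 0 ⇒ tcond (tvar 0)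
    ( (ƛ 1 ⇒ ƛ 2 ⇒ tcond (tvar 1)
        ( (ƛ 3 ⇒ ƛ 4 ⇒ ⟪ dispatch ⟫ ∙ tvar 3 ∙ tvar 4)
        ∷ (ƛ 3 ⇒ ƛ 4 ⇒ ƛ 5 ⇒ junk)
        ∷ (ƛ 5 ⇒ junk) ∷ []) ∙ tvar 2)
    ∷ (ƛ 1 ⇒ ƛ 2 ⇒ junk)
    ∷ junk ∷ []))

  stepTerm-sem : ∀ c → ⟪ stepTerm ⟫ ∙ t𝔻 ⌜ c ⌝cfg ⇝ t𝔻 ⌜ step′ c ⌝cfg
  stepTerm-sem (cfg q l h r) =
    ∙L (unfold stepTerm) ▶ β𝔻 ▶ cond-n₁ ▶ ∙L β𝔻 ▶ β𝔻 ▶ ∙L cond-n₁ ▶ ∙L (∙L β𝔻) ▶ ∙L β𝔻 ▶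
    ∙L (∙L (switch-numeral nStates dispatchSymbol _ q)) ▶
    ∙L (switch-numeral (3 + nExtra) (transition q) _ h) ▶
    ∙L (unfold (transitionTerm q h (δ q h))) ▶ transitionTerm-sem q h (δ q h) l r

  stepsTerm : ℕ → ClosedTemplate
  stepsTerm zero    = close (ƛ 1 ⇒ tvar 1)
  stepsTerm (suc n) = close (ƛ 1 ⇒ ⟪ stepTerm ⟫ ∙ (⟪ stepsTerm n ⟫ ∙ tvar 1))

  stepsTerm-sem : ∀ n c → ⟪ stepsTerm n ⟫ ∙ t𝔻 ⌜ c ⌝cfg ⇝ t𝔻 ⌜ fold c step′ n ⌝cfg
  stepsTerm-sem zero    c = ∙L (unfold (stepsTerm zero)) ▶ β𝔻
  stepsTerm-sem (suc n) c =
    ∙L (unfold (stepsTerm (suc n))) ▶ β𝔻 ▶ ∙R (stepsTerm-sem n c) ▶ stepTerm-sem _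

  noBits : ClosedTemplate
  noBits = close (ƛ 5 ⇒ t𝔹 [])

  noBits-sem : ∀ s → ⟪ noBits ⟫ ∙ t𝔹 s ⇝ t𝔹 []
  noBits-sem s = ∙L (unfold noBits) ▶ β𝔹

  cellTerm : Fin 3 → ClosedTemplate
  cellTerm fz           = noBits
  cellTerm (fs fz)      = close (ƛ 5 ⇒ cons𝔹 false ∙ tvar 5)
  cellTerm (fs (fs fz)) = close (ƛ 5 ⇒ cons𝔹 true ∙ tvar 5)

  cellTerm-sem : ∀ i s → ⟪ cellTerm i ⟫ ∙ t𝔹 s ⇝ t𝔹 (cellBits i s)
  cellTerm-sem fz           s = noBits-sem s
  cellTerm-sem (fs fz)      s = ∙L (unfold (cellTerm (fs fz))) ▶ β𝔹 ▶ same-term refl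
  cellTerm-sem (fs (fs fz)) s = ∙L (unfold (cellTerm (fs (fs fz)))) ▶ β𝔹 ▶ same-term refl

  readTapeBranches : List Template
  readTapeBranches =
    (ƛ 1 ⇒ ƛ 2 ⇒ ƛ 3 ⇒ ƛ 4 ⇒ ⟪ switch 3 cellTerm noBits ⟫ ∙ tvar 1 ∙ tvar 4)
    ∷ (ƛ 1 ⇒ ƛ 2 ⇒ ƛ 3 ⇒ ƛ 4 ⇒ t𝔹 [])
    ∷ t𝔹 [] ∷ []

  readTape-rec : ∀ x → trec (t𝔻 x) readTapeBranches ⇝ t𝔹 (readTape x)
  readTape-rec lf       = rec-lf
  readTape-rec (n₁ a l) =
    rec-n₁ ▶ ∙L (∙R (readTape-rec a)) ▶ ∙R (readTape-rec l) ▶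
    ∙L (∙L (∙L β𝔻)) ▶ ∙L (∙L β𝔻) ▶ ∙L β𝔹 ▶ β𝔹 ▶ ∙L (switch-select 3 cellTerm noBits a) ▶
    select-preserves (λ c f → ⟪ c ⟫ ∙ t𝔹 (readTape l) ⇝ t𝔹 (f (readTape l))) 3
      {g = cellBits} {e = λ _ → []} (λ i → cellTerm-sem i (readTape l)) (noBits-sem (readTape l)) a
  readTape-rec (n₂ a l) =
    rec-n₂ ▶ ∙L (∙R (readTape-rec a)) ▶ ∙R (readTape-rec l) ▶
    ∙L (∙L (∙L β𝔻)) ▶ ∙L (∙L β𝔻) ▶ ∙L β𝔹 ▶ β𝔹

  readTapeTerm : ClosedTemplate
  readTapeTerm = close (ƛ 0 ⇒ trec (tvar 0) readTapeBranches)

  outputTerm : ClosedTemplate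
  outputTerm = close (ƛ 0 ⇒ tcond (tvar 0)
    ( (ƛ 1 ⇒ ƛ 2 ⇒ tcond (tvar 1)
        ( (ƛ 3 ⇒ ƛ 4 ⇒ ƛ 5 ⇒ ⟪ readTapeTerm ⟫ ∙ pair (tvar 4) (tcond (tvar 5)
            ((ƛ 6 ⇒ ƛ 7 ⇒ tvar 7) ∷ (ƛ 6 ⇒ ƛ 7 ⇒ junk) ∷ junk ∷ [])))
        ∷ (ƛ 3 ⇒ ƛ 4 ⇒ ƛ 5 ⇒ t𝔹 [])
        ∷ (ƛ 5 ⇒ t𝔹 []) ∷ []) ∙ tvar 2)
    ∷ (ƛ 1 ⇒ ƛ 2 ⇒ t𝔹 [])
    ∷ t𝔹 [] ∷ []))

  outputTerm-sem : ∀ c → ⟪ outputTerm ⟫ ∙ t𝔻 ⌜ c ⌝cfg ⇝ t𝔹 (output c)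
  outputTerm-sem (cfg q l h r) =
    ∙L (unfold outputTerm) ▶ β𝔻 ▶ cond-n₁ ▶ ∙L β𝔻 ▶ β𝔻 ▶ ∙L cond-n₁ ▶ ∙L (∙L β𝔻) ▶ ∙L β𝔻 ▶ β𝔻 ▶
    ∙R (∙R cond-n₁) ▶ ∙R (∙R (∙L β𝔻)) ▶ ∙R (∙R β𝔻) ▶ ∙R (same-term {u = t𝔻 ⌜ h ∷ r ⌝tape} refl) ▶
    ∙L (unfold readTapeTerm) ▶ β𝔻 ▶ readTape-rec ⌜ h ∷ r ⌝tape ▶ same-term (cong encode (readTape-⌜⌝ (h ∷ r)))

  initTerm : ClosedTemplate
  initTerm = close (ƛ 0 ⇒ tcond (tvar 0)
    ( (ƛ 1 ⇒ ƛ 2 ⇒ pair (pair (t𝔻 ⌜ start ⌝state) (tvar 1)) (pair (t𝔻 lf) (tvar 2)))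
    ∷ (ƛ 1 ⇒ ƛ 2 ⇒ junk)
    ∷ t𝔻 ⌜ cfg start [] blank [] ⌝cfg ∷ []))

  initTerm-sem : ∀ l → ⟪ initTerm ⟫ ∙ t𝔻 ⌜ l ⌝tape ⇝ t𝔻 ⌜ initFromTape l ⌝cfg
  initTerm-sem []      = ∙L (unfold initTerm) ▶ β𝔻 ▶ cond-lf
  initTerm-sem (h ∷ r) = ∙L (unfold initTerm) ▶ β𝔻 ▶ cond-n₁ ▶ ∙L β𝔻 ▶ β𝔻 ▶ same-term refl

  module Typing {𝖣 : Ty → Set} where
    pair-con : RH 𝖣 [] (con (𝔻 , fz)) (𝔻¹ ⊸ 𝔻¹ ⊸ 𝔻¹)
    pair-con = conI _ 1

    junk-typed : RH 𝖣 [] (fill junk) 𝔻¹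
    junk-typed = conI _ 1

    moveTerm-typed : ∀ m q a → RH 𝖣 ((10 , 𝔻¹) ∷ (9 , 𝔻¹) ∷ []) (fill (moveTerm m q a)) 𝔻¹
    moveTerm-typed stay q a =
      reorder (app (app pair-con (⌜⌝𝔻-typed 1 (n₁ ⌜ q ⌝state ⌜ a ⌝sym))) (app (app pair-con ax) ax)) refl
    moveTerm-typed left q a = reorder (app (cond𝔻 1
      (lamI (lamI (lamI (reorder
        (app (app pair-con (app (app pair-con (⌜⌝𝔻-typed 1 ⌜ q ⌝state)) ax))
             (app (app pair-con ax) (app (app pair-con (⌜⌝𝔻-typed 1 ⌜ a ⌝sym)) ax))) refl))))
      (lamI (lamI (lamI (weaken (weaken (weaken junk-typed))))))
      (lamI (app (app pair-con (⌜⌝𝔻-typed 1 (n₁ ⌜ q ⌝state ⌜ blank ⌝sym)))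
                 (app (app pair-con (⌜⌝𝔻-typed 1 lf)) (app (app pair-con (⌜⌝𝔻-typed 1 ⌜ a ⌝sym)) ax))))
      ax) ax) refl
    moveTerm-typed right q a = reorder (app (cond𝔻 1
      (lamI (lamI (lamI (reorder
        (app (app pair-con (app (app pair-con (⌜⌝𝔻-typed 1 ⌜ q ⌝state)) ax))
             (app (app pair-con (app (app pair-con (⌜⌝𝔻-typed 1 ⌜ a ⌝sym)) ax)) ax)) refl))))
      (lamI (lamI (lamI (weaken (weaken (weaken junk-typed))))))
      (lamI (app (app pair-con (⌜⌝𝔻-typed 1 (n₁ ⌜ q ⌝state ⌜ blank ⌝sym)))
                 (app (app pair-con (app (app pair-con (⌜⌝𝔻-typed 1 ⌜ a ⌝sym)) ax)) (⌜⌝𝔻-typed 1 lf))))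
      ax) ax) refl

    splitTapes-typed : ∀ {M} → RH 𝖣 ((10 , 𝔻¹) ∷ (9 , 𝔻¹) ∷ []) M 𝔻¹ →
      RH 𝖣 [] (lam 8 (cond (var 8) (lam 9 (lam 10 M) ∷ lam 9 (lam 10 (fill junk)) ∷ fill junk ∷ [])))
              (𝔻¹ ⊸ 𝔻¹)
    splitTapes-typed d =
      lamI (cond𝔻 1 (lamI (lamI d)) (lamI (lamI (weaken (weaken junk-typed)))) junk-typed ax)

    transitionTerm-typed : ∀ q h δqh → RH 𝖣 [] (fill (proj₁ (transitionTerm q h δqh))) (𝔻¹ ⊸ 𝔻¹)
    transitionTerm-typed q h nothing = lamI (app (app pair-con (⌜⌝𝔻-typed 1 (n₁ ⌜ q ⌝state ⌜ h ⌝sym))) ax)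
    transitionTerm-typed q h (just (q′ , a , stay))  = splitTapes-typed (moveTerm-typed stay q′ a)
    transitionTerm-typed q h (just (q′ , a , left))  = splitTapes-typed (moveTerm-typed left q′ a)
    transitionTerm-typed q h (just (q′ , a , right)) = splitTapes-typed (moveTerm-typed right q′ a)

    stepTerm-typed : RH 𝖣 [] (fill (proj₁ stepTerm)) (𝔻¹ ⊸ 𝔻¹)
    stepTerm-typed = lamI (cond𝔻 1
      (lamI (lamI (reorder (app (cond𝔻 1
          (lamI (lamI (reorder (app (app dispatch-typed ax) ax) refl)))
          (lamI (lamI (lamI (weaken (weaken (weaken junk-typed))))))
          (lamI (weaken junk-typed)) ax) ax) refl)))
      (lamI (lamI (weaken (weaken junk-typed)))) junk-typed ax)
      where
      dispatch-typed : RH 𝖣 [] (fill (proj₁ dispatch)) (𝔻¹ ⊸ 𝔻¹ ⊸ 𝔻¹ ⊸ 𝔻¹)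
      dispatch-typed = switch-typed 1 nStates dispatchSymbol _
        (λ q → switch-typed 1 (3 + nExtra) (transition q) _
                 (λ h → transitionTerm-typed q h (δ q h)) (lamI (weaken junk-typed)))
        (lamI (lamI (weaken (weaken junk-typed))))

    stepsTerm-typed : ∀ n → RH 𝖣 [] (fill (proj₁ (stepsTerm n))) (𝔻¹ ⊸ 𝔻¹)
    stepsTerm-typed zero    = lamI ax
    stepsTerm-typed (suc n) = lamI (app stepTerm-typed (app (stepsTerm-typed n) ax))

    𝔹⁰-nil : RH 𝖣 [] (encode []) (base 𝔹 0)
    𝔹⁰-nil = conI _ 0

    readTapeTerm-typed : RH 𝖣 [] (fill (proj₁ readTapeTerm)) (𝔻¹ ⊸ base 𝔹 0)
    readTapeTerm-typed = lamI (rec𝔻 1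
      (lamI (lamI (lamI (lamI (reorder
        (weaken {x = 3} {A = base 𝔹 0} (weaken {x = 2} {A = 𝔻¹} (app (app cellSwitch-typed ax) ax))) refl)))))
      (lamI (lamI (lamI (lamI (weaken (weaken (weaken (weaken 𝔹⁰-nil))))))))
      𝔹⁰-nil (s≤s z≤n) ax)
      where
      noBits-typed : RH 𝖣 [] (fill (proj₁ noBits)) (base 𝔹 0 ⊸ base 𝔹 0)
      noBits-typed = lamI (weaken 𝔹⁰-nil)

      cellTerm-typed : ∀ i → RH 𝖣 [] (fill (proj₁ (cellTerm i))) (base 𝔹 0 ⊸ base 𝔹 0)
      cellTerm-typed fz           = noBits-typed
      cellTerm-typed (fs fz)      = lamI (app (cons𝔹-typed false 0) ax)
      cellTerm-typed (fs (fs fz)) = lamI (app (cons𝔹-typed true 0) ax)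

      cellSwitch-typed : RH 𝖣 [] (fill (proj₁ (switch 3 cellTerm noBits))) (𝔻¹ ⊸ base 𝔹 0 ⊸ base 𝔹 0)
      cellSwitch-typed = switch-typed 1 3 cellTerm noBits cellTerm-typed noBits-typed

    outputTerm-typed : RH 𝖣 [] (fill (proj₁ outputTerm)) (𝔻¹ ⊸ base 𝔹 0)
    outputTerm-typed = lamI (cond𝔻 1
      (lamI (lamI (reorder (app (cond𝔻 1
          (lamI (lamI (lamI (reorder (weaken {x = 3} {A = 𝔻¹}
            (app readTapeTerm-typed (app (app pair-con ax) (cond𝔻 1
              (lamI (lamI (reorder (weaken {x = 6} {A = 𝔻¹} ax) refl)))
              (lamI (lamI (weaken (weaken junk-typed)))) junk-typed ax)))) refl))))
          (lamI (lamI (lamI (weaken (weaken (weaken 𝔹⁰-nil))))))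
          (lamI (weaken 𝔹⁰-nil)) ax) ax) refl)))
      (lamI (lamI (weaken (weaken 𝔹⁰-nil)))) 𝔹⁰-nil ax)

    initTerm-typed : RH 𝖣 [] (fill (proj₁ initTerm)) (𝔻¹ ⊸ 𝔻¹)
    initTerm-typed = lamI (cond𝔻 1
      (lamI (lamI (reorder
        (app (app pair-con (app (app pair-con (⌜⌝𝔻-typed 1 ⌜ start ⌝state)) ax))
             (app (app pair-con (⌜⌝𝔻-typed 1 lf)) ax)) refl)))
      (lamI (lamI (weaken (weaken junk-typed))))
      (⌜⌝𝔻-typed 1 ⌜ cfg start [] blank [] ⌝cfg) ax)

  ≡cfg : ∀ {c c′} → c ≡ c′ → t𝔻 ⌜ c ⌝cfg ⇝ t𝔻 ⌜ c′ ⌝cfg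
  ≡cfg refl = same-term refl

  IsClock : (List Bool → ℕ) → ClosedTemplate → Set
  IsClock steps J = ∀ s c → ⟪ J ⟫ ∙ t𝔹 s ∙ t𝔻 ⌜ c ⌝cfg ⇝ t𝔻 ⌜ fold c step′ (steps s) ⌝cfg

  Continuation : ClosedTemplate → (List Sym → Config) → Set
  Continuation K g = Value (fill (proj₁ K)) × (∀ l → ⟪ K ⟫ ∙ t𝔻 ⌜ l ⌝tape ⇝ t𝔻 ⌜ g l ⌝cfg)

  module Loader (J : ClosedTemplate) (steps : List Bool → ℕ) (J-clock : IsClock steps J) where
    loadBit : Bool → Template
    loadBit b = ƛ 1 ⇒ ƛ 2 ⇒ ƛ 3 ⇒ ƛ 4 ⇒
      ⟪ J ⟫ ∙ tvar 1 ∙ (tvar 2 ∙ (ƛ 5 ⇒ tvar 3 ∙ pair (t𝔻 ⌜ bitSym b ⌝sym) (tvar 5)) ∙ tvar 4)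

    loadNil : Template
    loadNil = ƛ 3 ⇒ ƛ 4 ⇒ ⟪ J ⟫ ∙ t𝔹 [] ∙ (tvar 3 ∙ tvar 4)

    loadBranches : List Template
    loadBranches = loadBit false ∷ loadBit true ∷ loadNil ∷ []

    loadTime : List Bool → ℕ
    loadTime []      = steps []
    loadTime (_ ∷ t) = steps t + loadTime t

    loadTime-≥ : ∀ (bound : ℕ → ℕ) → bound 0 ≤ steps [] →
                 (∀ t → bound (suc (length t)) ≤ steps t) → ∀ s → bound (length s) ≤ loadTime s
    loadTime-≥ bound b₀ b-suc []      = b₀
    loadTime-≥ bound b₀ b-suc (_ ∷ t) = ≤-trans (b-suc t) (m≤m+n (steps t) (loadTime t))

    Loads : List Bool → ClosedTemplate → Set
    Loads s W = ∀ K g → Continuation K g → ∀ l →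
      ⟪ W ⟫ ∙ ⟪ K ⟫ ∙ t𝔻 ⌜ l ⌝tape ⇝ t𝔻 ⌜ fold (g (map bitSym s ++ l)) step′ (loadTime s) ⌝cfg

    load : ∀ s → Evaluates (trec (t𝔹 s) loadBranches) (Loads s)
    load [] = record
      { result = close loadNil ; evaluates = rec-[] ▶ same-term refl
      ; result-value = vLam ; result-has = loads }
      where
      loads : Loads [] (close loadNil)
      loads K g (K-value , K-sem) l =
        ∙L (∙L (unfold (close loadNil))) ▶ ∙L (βconst K-value) ▶ β𝔻 ▶ ∙R (K-sem l) ▶ J-clock [] (g l)
    load (b ∷ t) = record
      { result = W ; evaluates = evaluation ; result-value = vLam ; result-has = loads }
      where
      Wₜ = result (load t)
      W = close (ƛ 3 ⇒ ƛ 4 ⇒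
        ⟪ J ⟫ ∙ t𝔹 t ∙ (⟪ Wₜ ⟫ ∙ (ƛ 5 ⇒ tvar 3 ∙ pair (t𝔻 ⌜ bitSym b ⌝sym) (tvar 5)) ∙ tvar 4))

      evaluation : trec (t𝔹 (b ∷ t)) loadBranches ⇝ ⟪ W ⟫
      evaluation = rec-∷ b loadBit ▶ ∙R (evaluates (load t)) ▶ ∙L β𝔹 ▶
                   βconst (result-value (load t)) ▶ same-term refl

      loads : Loads (b ∷ t) W
      loads K g (K-value , K-sem) l =
        ∙L (∙L (unfold W)) ▶ ∙L (βconst K-value) ▶ β𝔻 ▶
        ∙R (∙L (∙R (same-term {u = ⟪ K′ ⟫} refl)) ▶
            result-has (load t) K′ (g ∘ (bitSym b ∷_)) (vLam , K′-sem) l) ▶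
        J-clock t _ ▶ ≡cfg (sym (fold-+ _ step′ (steps t)))
        where
        K′ = close (ƛ 5 ⇒ ⟪ K ⟫ ∙ pair (t𝔻 ⌜ bitSym b ⌝sym) (tvar 5))

        K′-sem : ∀ l → ⟪ K′ ⟫ ∙ t𝔻 ⌜ l ⌝tape ⇝ t𝔻 ⌜ g (bitSym b ∷ l) ⌝cfg
        K′-sem l = ∙L (unfold K′) ▶ β𝔻 ▶
          same-term {u = ⟪ K ⟫ ∙ t𝔻 ⌜ bitSym b ∷ l ⌝tape} refl ▶ K-sem (bitSym b ∷ l)

    machineTerm : ClosedTemplate
    machineTerm = close (ƛ 0 ⇒ ⟪ outputTerm ⟫ ∙ (trec (tvar 0) loadBranches ∙ ⟪ initTerm ⟫ ∙ t𝔻 lf))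

    machineTerm-sem : ∀ s → ⟪ machineTerm ⟫ ∙ t𝔹 s ⇝ t𝔹 (output (fold (init s) step′ (loadTime s)))
    machineTerm-sem s =
      ∙L (unfold machineTerm) ▶ β𝔹 ▶ ∙R (∙L (∙L (evaluates (load s)))) ▶
      ∙R (same-term {u = ⟪ result (load s) ⟫ ∙ ⟪ initTerm ⟫ ∙ t𝔻 ⌜ [] ⌝tape} refl) ▶
      ∙R (result-has (load s) initTerm initFromTape (vLam , initTerm-sem) []) ▶
      ∙R (≡cfg (cong (λ c → fold c step′ (loadTime s)) (initFromTape-bits s))) ▶
      outputTerm-sem _

    machineTerm-represents : ∀ {f} bound → ComputesInTime f bound → bound 0 ≤ steps [] →
      (∀ t → bound (suc (length t)) ≤ steps t) → Represents (fill (proj₁ machineTerm)) f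
    machineTerm-represents {f} bound computes b₀ b-suc s =
      reduces (machineTerm-sem s ▶ same-term {u = t𝔹 (f s)} (cong encode output≡))
      where
      output≡ : output (fold (init s) step′ (loadTime s)) ≡ f s
      output≡ = trans
        (cong output (fold-step′-halted (init s) (loadTime-≥ bound b₀ b-suc s) (proj₁ (computes s))))
        (proj₂ (computes s))

    module _ {𝖣 : Ty → Set} (L : ℕ) (1<L : 1 < L)
             (J-typed : RH 𝖣 [] (fill (proj₁ J)) (base 𝔹 L ⊸ 𝔻¹ ⊸ 𝔻¹)) where
      open Typing {𝖣}

      machineTerm-typed : RH 𝖣 [] (fill (proj₁ machineTerm)) (base 𝔹 L ⊸ base 𝔹 0)
      machineTerm-typed = lamI (app outputTerm-typed (app (app (rec𝔹 L
        (loadBit-typed false) (loadBit-typed true) loadNil-typed 1<L ax) initTerm-typed) (⌜⌝𝔻-typed 1 lf)))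
        where
        LoadTy : Ty
        LoadTy = (𝔻¹ ⊸ 𝔻¹) ⊸ 𝔻¹ ⊸ 𝔻¹

        loadBit-typed : ∀ b → RH 𝖣 [] (fill (loadBit b)) (base 𝔹 L ⊸ LoadTy ⊸ LoadTy)
        loadBit-typed b = lamI (lamI (lamI (lamI (reorder (app (app J-typed ax)
          (app (app ax (lamI (reorder {Δ = (5 , 𝔻¹) ∷ (3 , 𝔻¹ ⊸ 𝔻¹) ∷ []}
            (app ax (app (app pair-con (⌜⌝𝔻-typed 1 ⌜ bitSym b ⌝sym)) ax)) refl))) ax)) refl))))

        loadNil-typed : RH 𝖣 [] (fill loadNil) LoadTy
        loadNil-typed = lamI (lamI (reorder (app (app J-typed (conI _ L)) (app ax ax)) refl))

-- Clocks

module PolynomialClock (𝔉 : Family) (M : TM) (E : ℕ) where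
  open Terms 𝔉
  open Machine M
  open Simulation 𝔉 M

  -- The branch for a bit b with tail t runs the d-clock on b ∷ t and then the (d+1)-clock on t,
  -- which is the recurrence defining nestedSum.
  mutual
    clockBit : ℕ → Bool → Template
    clockBit d b = ƛ 1 ⇒ ƛ 2 ⇒ ƛ 3 ⇒ tvar 2 ∙ (⟪ clockTerm d ⟫ ∙ (cons𝔹 b ∙ tvar 1) ∙ tvar 3)

    clockBranches : ℕ → List Template
    clockBranches d = clockBit d false ∷ clockBit d true ∷ (ƛ 3 ⇒ ⟪ clockTerm d ⟫ ∙ t𝔹 [] ∙ tvar 3) ∷ []

    clockTerm : ℕ → ClosedTemplate
    clockTerm zero    = close (ƛ 0 ⇒ ƛ 1 ⇒ ⟪ stepsTerm E ⟫ ∙ tvar 1)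
    clockTerm (suc d) = close (ƛ 0 ⇒ trec (tvar 0) (clockBranches d))

  Runs : ℕ → List Bool → ClosedTemplate → Set
  Runs n s W = ∀ c → ⟪ W ⟫ ∙ t𝔻 ⌜ c ⌝cfg ⇝ t𝔻 ⌜ fold c step′ (nestedSum E n (length s)) ⌝cfg

  mutual
    clockTerm-clock : ∀ d → IsClock (λ s → nestedSum E d (length s)) (clockTerm d)
    clockTerm-clock zero s c =
      ∙L (∙L (unfold (clockTerm zero))) ▶ ∙L β𝔹 ▶ β𝔻 ▶ stepsTerm-sem E c
    clockTerm-clock (suc d) s c =
      ∙L (∙L (unfold (clockTerm (suc d)))) ▶ ∙L β𝔹 ▶ ∙L (evaluates (clock-rec d s)) ▶
      result-has (clock-rec d s) c

    clock-rec : ∀ d s → Evaluates (trec (t𝔹 s) (clockBranches d)) (Runs (suc d) s)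
    clock-rec d [] = record
      { result = W ; evaluates = rec-[] ▶ same-term refl ; result-value = vLam ; result-has = runs }
      where
      W = close (ƛ 3 ⇒ ⟪ clockTerm d ⟫ ∙ t𝔹 [] ∙ tvar 3)
      runs : Runs (suc d) [] W
      runs c = ∙L (unfold W) ▶ β𝔻 ▶ clockTerm-clock d [] c
    clock-rec d (b ∷ t) = record
      { result = W ; evaluates = evaluation ; result-value = vLam ; result-has = runs }
      where
      Wₜ = result (clock-rec d t)
      W = close (ƛ 3 ⇒ ⟪ Wₜ ⟫ ∙ (⟪ clockTerm d ⟫ ∙ (cons𝔹 b ∙ t𝔹 t) ∙ tvar 3))

      evaluation : trec (t𝔹 (b ∷ t)) (clockBranches d) ⇝ ⟪ W ⟫
      evaluation = rec-∷ b (clockBit d) ▶ ∙R (evaluates (clock-rec d t)) ▶ ∙L β𝔹 ▶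
                   βconst (result-value (clock-rec d t)) ▶ same-term refl

      runs : Runs (suc d) (b ∷ t) W
      runs c =
        ∙L (unfold W) ▶ β𝔻 ▶ ∙R (∙L (∙R (same-term {u = t𝔹 (b ∷ t)} (cons𝔹-encode b t)))) ▶
        ∙R (clockTerm-clock d (b ∷ t) c) ▶ result-has (clock-rec d t) _ ▶
        ≡cfg (sym (fold-+ c step′ (nestedSum E (suc d) (length t))))

  polyClock : ℕ → ℕ → ClosedTemplate
  polyClock k p = close (ƛ 0 ⇒ ƛ 1 ⇒ ⟪ clockTerm k ⟫ ∙ (⟪ padTerm p ⟫ ∙ tvar 0) ∙ tvar 1)

  polyClock-clock : ∀ k p → IsClock (λ s → nestedSum E k (p + length s)) (polyClock k p)
  polyClock-clock k p s c =
    ∙L (∙L (unfold (polyClock k p))) ▶ ∙L β𝔹 ▶ β𝔻 ▶ ∙L (∙R (padTerm-sem p s)) ▶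
    clockTerm-clock k _ c ▶ ≡cfg (cong (λ n → fold c step′ (nestedSum E k n)) (length-pad p s))

  module _ {𝖣 : Ty → Set} where
    open Typing {𝖣}

    clockTerm-typed : ∀ d → RH 𝖣 [] (fill (proj₁ (clockTerm d))) (base 𝔹 2 ⊸ 𝔻¹ ⊸ 𝔻¹)
    clockTerm-typed zero =
      lamI (lamI (reorder (weaken {x = 0} {A = base 𝔹 2} (app (stepsTerm-typed E) ax)) refl))
    clockTerm-typed (suc d) = lamI (rec𝔹 2 (clockBit-typed false) (clockBit-typed true)
      (lamI (app (app (clockTerm-typed d) (conI _ 2)) ax)) (s≤s (s≤s z≤n)) ax)
      where
      clockBit-typed : ∀ b → RH 𝖣 [] (fill (clockBit d b)) (base 𝔹 2 ⊸ (𝔻¹ ⊸ 𝔻¹) ⊸ (𝔻¹ ⊸ 𝔻¹))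
      clockBit-typed b = lamI (lamI (lamI (reorder
        (app ax (app (app (clockTerm-typed d) (app (cons𝔹-typed b 2) ax)) ax)) refl)))

    polyClock-typed : ∀ k p → RH 𝖣 [] (fill (proj₁ (polyClock k p))) (base 𝔹 2 ⊸ 𝔻¹ ⊸ 𝔻¹)
    polyClock-typed k p =
      lamI (lamI (reorder (app (app (clockTerm-typed k) (app (padTerm-typed 2 p) ax)) ax) refl))

module TowerClock (𝔉 : Family) (M : TM) where
  open Terms 𝔉
  open Machine M
  open Simulation 𝔉 M

  ℂnode : Template
  ℂnode = tconst (con (ℂ , fz)) (λ _ _ → refl)

  combBit : Template
  combBit = ƛ 1 ⇒ ƛ 2 ⇒ ℂnode ∙ tℂ leaf ∙ tvar 2

  combTerm : ClosedTemplate
  combTerm = close (ƛ 0 ⇒ trec (tvar 0) (combBit ∷ combBit ∷ tℂ leaf ∷ []))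

  combTerm-sem : ∀ s → ⟪ combTerm ⟫ ∙ t𝔹 s ⇝ tℂ (comb (length s))
  combTerm-sem s = ∙L (unfold combTerm) ▶ β𝔹 ▶ comb-rec s
    where
    comb-rec : ∀ s → trec (t𝔹 s) (combBit ∷ combBit ∷ tℂ leaf ∷ []) ⇝ tℂ (comb (length s))
    comb-rec []      = rec-[]
    comb-rec (b ∷ t) = rec-∷ b (λ _ → combBit) ▶ ∙R (comb-rec t) ▶ ∙L β𝔹 ▶ βℂ ▶ same-term refl

  doubleTerm : ClosedTemplate
  doubleTerm = close (ƛ 5 ⇒ ℂnode ∙ tvar 5 ∙ tvar 5)

  module Exponential = TreeIteration tℂ (λ T → vCT (⌜⌝ℂ-ct T)) double doubleTerm vLam
    (λ T → ∙L (unfold doubleTerm) ▶ βℂ ▶ same-term refl)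

  module Iterated = TreeIteration (t𝔻 ∘ ⌜_⌝cfg) (λ c → vCT (⌜⌝𝔻-ct ⌜ c ⌝cfg)) step′ stepTerm vLam
    stepTerm-sem

  expTerm : ClosedTemplate
  expTerm = close (ƛ 0 ⇒ trec (tvar 0) Exponential.iterationBranches)

  expTerm-sem : ∀ T z → ⟪ expTerm ⟫ ∙ tℂ T ∙ tℂ z ⇝ tℂ (fold z double (leaves T))
  expTerm-sem T z =
    ∙L (∙L (unfold expTerm)) ▶ ∙L βℂ ▶ ∙L (evaluates (Exponential.iterate-rec T)) ▶
    result-has (Exponential.iterate-rec T) z

  towerChain : ℕ → ClosedTemplate
  towerChain zero    = close (ƛ 0 ⇒ trec (tvar 0) Iterated.iterationBranches)
  towerChain (suc i) = close (ƛ 0 ⇒ ⟪ towerChain i ⟫ ∙ (⟪ expTerm ⟫ ∙ tvar 0 ∙ tℂ leaf))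

  towerChain-sem : ∀ i T c →
    ⟪ towerChain i ⟫ ∙ tℂ T ∙ t𝔻 ⌜ c ⌝cfg ⇝ t𝔻 ⌜ fold c step′ (tower i (leaves T)) ⌝cfg
  towerChain-sem zero T c =
    ∙L (∙L (unfold (towerChain zero))) ▶ ∙L βℂ ▶ ∙L (evaluates (Iterated.iterate-rec T)) ▶
    result-has (Iterated.iterate-rec T) c
  towerChain-sem (suc i) T c =
    ∙L (∙L (unfold (towerChain (suc i)))) ▶ ∙L βℂ ▶ ∙L (∙R (expTerm-sem T leaf)) ▶
    towerChain-sem i _ c ▶
    ≡cfg (cong (fold c step′)
      (trans (cong (tower i) (leaves-double (leaves T))) (tower-2^ i (leaves T))))

  towerClock : ℕ → ℕ → ClosedTemplate
  towerClock h p =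
    close (ƛ 0 ⇒ ƛ 1 ⇒ ⟪ towerChain h ⟫ ∙ (⟪ combTerm ⟫ ∙ (⟪ padTerm p ⟫ ∙ tvar 0)) ∙ tvar 1)

  towerClock-clock : ∀ h p → IsClock (λ s → tower h (suc (p + length s))) (towerClock h p)
  towerClock-clock h p s c =
    ∙L (∙L (unfold (towerClock h p))) ▶ ∙L β𝔹 ▶ β𝔻 ▶ ∙L (∙R (∙R (padTerm-sem p s))) ▶
    ∙L (∙R (combTerm-sem _)) ▶ towerChain-sem h _ c ▶
    ≡cfg (cong (λ n → fold c step′ (tower h n)) (trans (leaves-comb _) (cong suc (length-pad p s))))

  open Typing {BaseTypes}

  combTerm-typed : ∀ j → RH BaseTypes [] (fill (proj₁ combTerm)) (base 𝔹 (suc j) ⊸ base ℂ j)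
  combTerm-typed j = lamI (rec𝔹 (suc j) combBit-typed combBit-typed (conI _ j) (n<1+n j) ax)
    where
    combBit-typed : RH BaseTypes [] (fill combBit) (base 𝔹 (suc j) ⊸ base ℂ j ⊸ base ℂ j)
    combBit-typed = lamI (lamI (reorder
      (weaken {x = 1} {A = base 𝔹 (suc j)} (app (app (conI _ j) (conI _ j)) ax)) refl))

  -- The only use of contraction, on the base type ℂ^j: this is what part (ii) needs RH(𝖠) for.
  doubleTerm-typed : ∀ j → RH BaseTypes [] (fill (proj₁ doubleTerm)) (base ℂ j ⊸ base ℂ j)
  doubleTerm-typed j =
    lamI (contract {x = 6} {y = 7} {z = 5} (ℂ , j , refl) (app (app (conI _ j) ax) ax))

  expTerm-typed : ∀ j → RH BaseTypes [] (fill (proj₁ expTerm)) (base ℂ (suc j) ⊸ base ℂ j ⊸ base ℂ j)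
  expTerm-typed j = lamI (recℂ (suc j) (composeNode-typed (suc j)) (doubleTerm-typed j)
    (s≤s (≤-reflexive (⊔-idem j))) ax)

  towerChain-typed : ∀ i → RH BaseTypes [] (fill (proj₁ (towerChain i))) (base ℂ (2 + i) ⊸ 𝔻¹ ⊸ 𝔻¹)
  towerChain-typed zero    = lamI (recℂ 2 (composeNode-typed 2) stepTerm-typed (s≤s (s≤s z≤n)) ax)
  towerChain-typed (suc i) =
    lamI (app (towerChain-typed i) (app (app (expTerm-typed (2 + i)) ax) (conI _ (2 + i))))

  towerClock-typed : ∀ h p → RH BaseTypes [] (fill (proj₁ (towerClock h p))) (base 𝔹 (3 + h) ⊸ 𝔻¹ ⊸ 𝔻¹)
  towerClock-typed h p = lamI (lamI (reorder (app (app (towerChain-typed h)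
    (app (combTerm-typed (2 + h)) (app (padTerm-typed (3 + h) p) ax))) ax) refl))

module _ (𝔉 : Family) where
  open Terms 𝔉

  polytime : (f : List Bool → List Bool) → PolyTimeComputable f →
    Σ Tm (λ M → Σ ℕ (λ n → RH NoTypes [] M (base 𝔹 n ⊸ base 𝔹 0) × Represents M f))
  -- Padding by c and E = k! base steps make the clock run at least (n + c) ^ k steps.
  polytime f (M , c , k , computes) =
    fill (proj₁ machineTerm) , 2 , machineTerm-typed 2 (s≤s (s≤s z≤n)) (polyClock-typed k c) ,
    machineTerm-represents (λ n → (n + c) ^ k) computes
      (^-≤-nestedSum k (≤-trans (m≤m+n c 0) (n≤1+n (c + 0))))
      (λ t → ^-≤-nestedSum k (≤-reflexive (cong suc (+-comm (length t) c))))
    where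
    open Simulation 𝔉 M
    open PolynomialClock 𝔉 M (k !)
    open Loader (polyClock k c) (λ s → nestedSum (k !) k (c + length s)) (polyClock-clock k c)

  elementary : (f : List Bool → List Bool) → ElementaryTimeComputable f →
    Σ Tm (λ M → Σ ℕ (λ n → RH BaseTypes [] M (base 𝔹 n ⊸ base 𝔹 0) × Represents M f))
  elementary f (M , h , c , computes) =
    fill (proj₁ machineTerm) , 3 + h ,
    machineTerm-typed (3 + h) (s≤s (s≤s z≤n)) (towerClock-typed h c) ,
    machineTerm-represents (λ n → tower h (n + c)) computes
      (tower-monoʳ-≤ h (≤-trans (m≤m+n c 0) (n≤1+n (c + 0))))
      (λ t → tower-monoʳ-≤ h (≤-reflexive (cong suc (+-comm (length t) c))))
    where
    open Simulation 𝔉 M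
    open TowerClock 𝔉 M
    open Loader (towerClock h c) (λ s → tower h (suc (c + length s))) (towerClock-clock h c)

theorem6 : (𝔉 : Family) → let open Lang 𝔉 in
    ((f : List Bool → List Bool) → PolyTimeComputable f →
      Σ Tm (λ M → Σ ℕ (λ n →
        RH NoTypes [] M (base 𝔹 n ⊸ base 𝔹 0) × Represents M f)))
    ×
    ((f : List Bool → List Bool) → ElementaryTimeComputable f →
      Σ Tm (λ M → Σ ℕ (λ n →
        RH BaseTypes [] M (base 𝔹 n ⊸ base 𝔹 0) × Represents M f)))
theorem6 𝔉 = polytime 𝔉 , elementary 𝔉
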